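{- Given a formula $\varphi\in\mathcal{L}$ and an ordered model $M$, deciding whether $M\models\varphi$ can be done in time polynomial in the sizes of $\varphi$ and $M$.
   Context: Let $\mathcal{U}$ be a countable set of goal atoms. The language $\mathcal{L}$ over $\mathcal{U}$ is the smallest set containing every $a\in\mathcal{U}$ and closed under: if $\varphi,\psi\in\mathcal{L}$ then $(\neg\varphi),(\varphi\land\psi),(\square\varphi)\in\mathcal{L}$ (other connectives such as $\lor,\supset,\Diamond,<$ are abbreviations: $\varphi\lor\psi:=\neg(\neg\varphi\land\neg\psi)$, $\varphi\supset\psi:=\neg\varphi\lor\psi$, $\Diamond\varphi:=\neg\square\neg\varphi$, $\varphi<\psi:=\psi\supset\Diamond\varphi$). An ordered model is a finite sequence of atoms from $\mathcal{U}$ without repetition. $P$ is a prefix of $Q$ iff $Q=PR$ for some possibly empty sequence $R$. Truth: $M\models a$ iff $a$ occurs in $M$; $M\models\neg\psi$ iff $M\not\models\psi$; $M\models\psi\land\varphi$ iff both hold; $M\models\square\varphi$ iff $M'\models\varphi$ for every prefix $M'$ of $M$ (including the empty sequence and $M$ itself). -}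

module Defs where

open import Data.Nat using (ℕ; zero; suc; _+_; _*_; _^_; _≤_)
open import Data.Nat.Binary.Base using (ℕᵇ; 2[1+_]; 1+[2_]) renaming (zero to zeroᵇ; fromℕ to toBin)
open import Data.Fin using (Fin)
open import Data.Bool using (Bool; true; false)
open import Data.List using (List; []; _∷_; _++_; length; concatMap)
open import Data.List.Membership.Propositional using (_∈_)
open import Data.Product using (Σ; ∃; _×_; _,_)
open import Data.Sum using (_⊎_; inj₁; inj₂)
open import Relation.Nullary using (¬_)
open import Relation.Binary.PropositionalEquality using (_≡_)

-- Logic: goal atoms are natural numbers (a countable set 𝒰)

data Fml : Set where
  atom : ℕ → Fml
  ¬'_  : Fml → Fml
  _∧'_ : Fml → Fml → Fml
  □_   : Fml → Fml

-- An ordered model is a list of atoms without repetition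
-- (the no-repetition condition is imposed in the statement via Unique).
Model : Set
Model = List ℕ

_IsPrefixOf_ : Model → Model → Set
P IsPrefixOf Q = ∃ λ R → Q ≡ P ++ R

infix 4 _⊨_
_⊨_ : Model → Fml → Set
M ⊨ atom a  = a ∈ M
M ⊨ ¬' φ    = ¬ (M ⊨ φ)
M ⊨ φ ∧' ψ  = (M ⊨ φ) × (M ⊨ ψ)
M ⊨ □ φ     = ∀ M' → M' IsPrefixOf M → M' ⊨ φ

data Sym : Set where
  d1 d2 : Sym          -- digits of bijective base-2 numerals
  A N K B : Sym        -- atom-start, negation, conjunction, box (Polish notation)
  E : Sym              -- end of a numeral
  # : Sym              -- separator between formula and model

-- bijective base-2 numeral, least significant digit first
encBin : ℕᵇ → List Sym
encBin zeroᵇ     = []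
encBin 2[1+ n ]  = d2 ∷ encBin n
encBin 1+[2 n ]  = d1 ∷ encBin n

encAtom : ℕ → List Sym
encAtom a = encBin (toBin a) ++ (E ∷ [])

encFml : Fml → List Sym
encFml (atom a)  = A ∷ encAtom a
encFml (¬' φ)    = N ∷ encFml φ
encFml (φ ∧' ψ)  = K ∷ (encFml φ ++ encFml ψ)
encFml (□ φ)     = B ∷ encFml φ

encModel : Model → List Sym
encModel = concatMap encAtom

input : Fml → Model → List Sym
input φ M = encFml φ ++ (# ∷ encModel M)

data Dir : Set where
  L R S : Dir

data Γ (extra : ℕ) : Set where
  blank : Γ extra
  inp   : Sym → Γ extra
  aux   : Fin extra → Γ extra

record TM : Set where
  field
    states : ℕ
    extra  : ℕ
    start  : Fin states
    -- a transition either halts with a Boolean answer, or moves on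
    δ      : Fin states → Γ extra → Bool ⊎ (Fin states × Γ extra × Dir)

module _ (T : TM) where
  open TM T

  -- tape: reversed part left of the head, symbol under head, part right of head
  data Config : Set where
    running : Fin states → List (Γ extra) → Γ extra → List (Γ extra) → Config
    halted  : Bool → Config

  move : Dir → List (Γ extra) → Γ extra → List (Γ extra) →
         List (Γ extra) × Γ extra × List (Γ extra)
  move S ls h rs              = ls , h , rs
  move L []        h rs       = [] , h , rs
  move L (l ∷ ls)  h rs       = ls , l , h ∷ rs
  move R ls        h []       = h ∷ ls , blank , []
  move R ls        h (r ∷ rs) = h ∷ ls , r , rs

  step : Config → Config
  step (halted b) = halted b
  step (running q ls h rs) with δ q h
  ... | inj₁ b = halted b
  ... | inj₂ (q' , w , d) with move d ls w rs
  ...   | ls' , h' , rs' = running q' ls' h' rs'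

  run : ℕ → Config → Config
  run zero    c = c
  run (suc n) c = run n (step c)

  initial : List Sym → Config
  initial []       = running start [] blank []
  initial (s ∷ ss) = running start [] (inp s) (Data.List.map inp ss)

  HaltsWithin : List Sym → ℕ → Bool → Set
  HaltsWithin w t b = run t (initial w) ≡ halted b

module Submission where

open import Defs
open import Data.Bool using (Bool; true; false; _∧_; _∨_; not; if_then_else_)
open import Data.Bool.Properties using (∧-identityʳ; ∧-zeroʳ; ∧-assoc; ∨-assoc)
open import Data.Empty using (⊥-elim)
open import Data.Fin using (Fin; combine; remQuot; splitAt; join) renaming (zero to fz; suc to fs)
import Data.Fin.Properties as FinP
open import Data.List using (List; []; _∷_; _++_; _ʳ++_; length; map; take; drop; _∷ʳ_)
import Data.List.Properties as LP
open import Data.List.Membership.Propositional using (_∈_)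
open import Data.List.Relation.Unary.All using (All; []; _∷_)
import Data.List.Relation.Unary.All.Properties as AllP
open import Data.List.Relation.Unary.Any using (here; there)
open import Data.List.Relation.Unary.Unique.Propositional using (Unique)
open import Data.Maybe using (Maybe; just; nothing)
open import Data.Nat using (ℕ; zero; suc; _+_; _*_; _^_; _∸_; _⊔_; _⊓_; _≤_; _<_; z≤n; s≤s; _≟_)
import Data.Nat.Properties as NP
open import Data.Nat.Binary.Base using (2[1+_]; 1+[2_]; fromℕ; toℕ) renaming (zero to zeroᵇ)
import Data.Nat.Binary.Properties as BinP
open import Data.Nat.Solver using (module +-*-Solver)
open import Data.Product using (Σ; ∃; _×_; _,_; proj₁; proj₂)
open import Data.Sum using (_⊎_; inj₁; inj₂)
import Data.Sum as Sum
open import Data.Unit using (⊤; tt)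
open import Relation.Binary.PropositionalEquality
open import Relation.Nullary using (¬_; yes; no)
open import Relation.Nullary.Decidable using (isYes)

-- The machine evaluates φ on every prefix of M in turn, keeping φ on the tape in Polish
-- notation with a truth value at each node.  For a fixed prefix, one round per level of φ
-- computes the node values bottom-up.  The prefixes of take k M are the take j M with
-- j ≤ k, so □ψ holds at k iff ψ holds at every j ≤ k; a □-node therefore only has to
-- remember whether ψ held on all shorter prefixes.  Then the next atom of M is read digit
-- by digit and compared with every atom code in φ, which updates the membership bit of each
-- atom occurrence, and the next prefix is processed.  A round is one sweep to the right and
-- one back, O(n) steps on an input of length n; there are O(n) rounds per prefix and O(n)
-- prefixes, hence O(n³) steps.

false≢true : false ≡ true → ∀ {X : Set} → X
false≢true ()

-- Semantics on prefixes

elemᵇ : ℕ → List ℕ → Bool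
elemᵇ a [] = false
elemᵇ a (x ∷ xs) = isYes (a ≟ x) ∨ elemᵇ a xs

elemᵇ⇒∈ : ∀ a xs → elemᵇ a xs ≡ true → a ∈ xs
elemᵇ⇒∈ a (x ∷ xs) eq with a ≟ x
... | yes a≡x = here a≡x
... | no _ = there (elemᵇ⇒∈ a xs eq)

elemᵇ⇒∉ : ∀ a xs → elemᵇ a xs ≡ false → ¬ (a ∈ xs)
elemᵇ⇒∉ a (x ∷ xs) eq with a ≟ x
... | yes _ = false≢true (sym eq)
... | no a≢x = λ { (here a≡x) → a≢x a≡x ; (there a∈xs) → elemᵇ⇒∉ a xs eq a∈xs }

elemᵇ-∷ʳ : ∀ a xs m → elemᵇ a (xs ∷ʳ m) ≡ elemᵇ a xs ∨ isYes (a ≟ m)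
elemᵇ-∷ʳ a [] m with a ≟ m
... | yes _ = refl
... | no _ = refl
elemᵇ-∷ʳ a (x ∷ xs) m rewrite elemᵇ-∷ʳ a xs m = sym (∨-assoc (isYes (a ≟ x)) (elemᵇ a xs) _)

Decides : Bool → Set → Set
Decides b P = (b ≡ true → P) × (b ≡ false → ¬ P)

take-length-++ : ∀ {A : Set} (xs ys : List A) → take (length xs) (xs ++ ys) ≡ xs
take-length-++ [] ys = refl
take-length-++ (x ∷ xs) ys = cong (x ∷_) (take-length-++ xs ys)

take-take-≤ : ∀ {A : Set} {j k} (xs : List A) → j ≤ k → take j (take k xs) ≡ take j xs
take-take-≤ {j = j} {k} xs j≤k = trans (LP.take-take j k xs) (cong (λ n → take n xs) (NP.m≤n⇒m⊓n≡m j≤k))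

prefix-of-take : ∀ k (M M′ M″ : Model) → take k M ≡ M′ ++ M″ → length M′ ≤ k × M′ ≡ take (length M′) M
prefix-of-take k M M′ M″ eq = length≤k , M′≡take
  where
  length≤k : length M′ ≤ k
  length≤k = begin
    length M′          ≤⟨ LP.length-++-≤ˡ M′ ⟩
    length (M′ ++ M″)  ≡⟨ cong length eq ⟨
    length (take k M)  ≡⟨ LP.length-take k M ⟩
    k ⊓ length M       ≤⟨ NP.m⊓n≤m k (length M) ⟩
    k                  ∎
    where open NP.≤-Reasoning
  M′≡take : M′ ≡ take (length M′) M
  M′≡take = begin
    M′                           ≡⟨ take-length-++ M′ M″ ⟨
    take (length M′) (M′ ++ M″)  ≡⟨ cong (take (length M′)) eq ⟨
    take (length M′) (take k M)  ≡⟨ take-take-≤ M length≤k ⟩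
    take (length M′) M           ∎
    where open ≡-Reasoning

take-prefix : ∀ {j k} (M : Model) → j ≤ k → take j M IsPrefixOf take k M
take-prefix {j} {k} M j≤k = drop j (take k M) ,
  trans (sym (LP.take++drop≡id j (take k M))) (cong (_++ drop j (take k M)) (take-take-≤ M j≤k))

module PrefixSemantics (M : Model) where

  mutual
    evalAt : Fml → ℕ → Bool
    evalAt (atom a) k = elemᵇ a (take k M)
    evalAt (¬' ψ) k = not (evalAt ψ k)
    evalAt (φ ∧' ψ) k = evalAt φ k ∧ evalAt ψ k
    evalAt (□ ψ) k = holdsBelow ψ (suc k)

    holdsBelow : Fml → ℕ → Bool
    holdsBelow ψ zero = true
    holdsBelow ψ (suc k) = holdsBelow ψ k ∧ evalAt ψ k

  holdsBelow-true : ∀ ψ k → holdsBelow ψ k ≡ true → ∀ j → j < k → evalAt ψ j ≡ true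
  holdsBelow-true ψ (suc k) eq j (s≤s j≤k) with holdsBelow ψ k in e1 | evalAt ψ k in e2
  ... | true | true with NP.m≤n⇒m<n∨m≡n j≤k
  ...   | inj₁ j<k = holdsBelow-true ψ k e1 j j<k
  ...   | inj₂ refl = e2

  holdsBelow-false : ∀ ψ k → holdsBelow ψ k ≡ false → ∃ λ j → j < k × evalAt ψ j ≡ false
  holdsBelow-false ψ (suc k) eq with holdsBelow ψ k in e1 | evalAt ψ k in e2
  ... | false | _ = let (j , j<k , ev) = holdsBelow-false ψ k e1 in j , NP.m≤n⇒m≤1+n j<k , ev
  ... | true | false = k , NP.≤-refl , e2

  evalAt-correct : ∀ χ k → Decides (evalAt χ k) (take k M ⊨ χ)
  evalAt-correct (atom a) k = elemᵇ⇒∈ a (take k M) , elemᵇ⇒∉ a (take k M)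
  evalAt-correct (¬' ψ) k with evalAt ψ k in e
  ... | true = (λ ()) , (λ _ ¬ψ → ¬ψ (proj₁ (evalAt-correct ψ k) e))
  ... | false = (λ _ → proj₂ (evalAt-correct ψ k) e) , (λ ())
  evalAt-correct (φ ∧' ψ) k with evalAt φ k in e1 | evalAt ψ k in e2
  ... | true | true = (λ _ → proj₁ (evalAt-correct φ k) e1 , proj₁ (evalAt-correct ψ k) e2) , (λ ())
  ... | false | _ = (λ ()) , (λ _ φ∧ψ → proj₂ (evalAt-correct φ k) e1 (proj₁ φ∧ψ))
  ... | true | false = (λ ()) , (λ _ φ∧ψ → proj₂ (evalAt-correct ψ k) e2 (proj₂ φ∧ψ))
  evalAt-correct (□ ψ) k = all-prefixes , some-prefix
    where
    all-prefixes : holdsBelow ψ (suc k) ≡ true → take k M ⊨ □ ψ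
    all-prefixes eq M′ (M″ , e) with prefix-of-take k M M′ M″ e
    ... | (length≤k , M′≡take) = subst (_⊨ ψ) (sym M′≡take)
      (proj₁ (evalAt-correct ψ (length M′)) (holdsBelow-true ψ (suc k) eq (length M′) (s≤s length≤k)))
    some-prefix : holdsBelow ψ (suc k) ≡ false → ¬ (take k M ⊨ □ ψ)
    some-prefix eq □ψ with holdsBelow-false ψ (suc k) eq
    ... | (j , s≤s j≤k , ev) = proj₂ (evalAt-correct ψ j) ev (□ψ (take j M) (take-prefix M j≤k))

-- Finite types

record Finite (A : Set) : Set where
  field
    size : ℕ
    enc : A → Fin size
    dec : Fin size → A
    dec-enc : ∀ a → dec (enc a) ≡ a
open Finite public

retractFinite : {A B : Set} → Finite A → (f : A → B) (g : B → A) → (∀ b → f (g b) ≡ b) → Finite B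
retractFinite FA f g fg = record
  { size = size FA ; enc = λ b → enc FA (g b) ; dec = λ i → f (dec FA i)
  ; dec-enc = λ b → trans (cong f (dec-enc FA (g b))) (fg b) }

opaque
  pairEnc : ∀ {m n} → Fin m → Fin n → Fin (m * n)
  pairEnc = combine
  pairDec : ∀ {m} n → Fin (m * n) → Fin m × Fin n
  pairDec {m} n i = remQuot {m} n i
  pairDecEnc : ∀ {m n} (i : Fin m) (j : Fin n) → pairDec {m} n (pairEnc i j) ≡ (i , j)
  pairDecEnc {m} {n} i j = FinP.remQuot-combine {m} {n} i j
  sumEnc : ∀ {m n} → Fin m ⊎ Fin n → Fin (m + n)
  sumEnc {m} {n} x = join m n x
  sumDec : ∀ {m n} → Fin (m + n) → Fin m ⊎ Fin n
  sumDec {m} {n} i = splitAt m {n} i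
  sumDecEnc : ∀ {m n} (x : Fin m ⊎ Fin n) → sumDec {m} {n} (sumEnc x) ≡ x
  sumDecEnc {m} {n} x = FinP.splitAt-join m n x

×-finite : {A B : Set} → Finite A → Finite B → Finite (A × B)
×-finite FA FB = record
  { size = size FA * size FB
  ; enc = λ { (a , b) → pairEnc (enc FA a) (enc FB b) }
  ; dec = λ i → dec FA (proj₁ (pairDec {size FA} (size FB) i)) , dec FB (proj₂ (pairDec {size FA} (size FB) i))
  ; dec-enc = λ { (a , b) → dec-enc-pair a b } }
  where
  dec-enc-pair : ∀ a b → (dec FA (proj₁ (pairDec {size FA} (size FB) (pairEnc (enc FA a) (enc FB b)))) ,
                 dec FB (proj₂ (pairDec {size FA} (size FB) (pairEnc (enc FA a) (enc FB b))))) ≡ (a , b)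
  dec-enc-pair a b = trans (cong (λ p → dec FA (proj₁ p) , dec FB (proj₂ p))
                    (pairDecEnc (enc FA a) (enc FB b)))
                  (cong₂ _,_ (dec-enc FA a) (dec-enc FB b))

⊎-finite : {A B : Set} → Finite A → Finite B → Finite (A ⊎ B)
⊎-finite FA FB = record
  { size = size FA + size FB
  ; enc = λ x → sumEnc (Sum.map (enc FA) (enc FB) x)
  ; dec = λ i → Sum.map (dec FA) (dec FB) (sumDec {size FA} {size FB} i)
  ; dec-enc = dec-enc-sum }
  where
  dec-enc-sum : ∀ x → Sum.map (dec FA) (dec FB) (sumDec {size FA} {size FB} (sumEnc (Sum.map (enc FA) (enc FB) x))) ≡ x
  dec-enc-sum x rewrite sumDecEnc {size FA} {size FB} (Sum.map (enc FA) (enc FB) x) with x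
  ... | inj₁ a = cong inj₁ (dec-enc FA a)
  ... | inj₂ b = cong inj₂ (dec-enc FB b)

⊤-finite : Finite ⊤
⊤-finite = record { size = 1 ; enc = λ _ → fz ; dec = λ _ → tt ; dec-enc = λ _ → refl }

Bool-finite : Finite Bool
Bool-finite = retractFinite (⊎-finite ⊤-finite ⊤-finite) (λ { (inj₁ _) → true ; (inj₂ _) → false })
                 (λ { true → inj₁ tt ; false → inj₂ tt }) (λ { true → refl ; false → refl })

Maybe-finite : {A : Set} → Finite A → Finite (Maybe A)
Maybe-finite FA = retractFinite (⊎-finite ⊤-finite FA) (λ { (inj₁ _) → nothing ; (inj₂ a) → just a })
                 (λ { nothing → inj₁ tt ; (just a) → inj₂ a }) (λ { nothing → refl ; (just a) → refl })

fromFinSym : Fin 8 → Sym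
fromFinSym fz = d1
fromFinSym (fs fz) = d2
fromFinSym (fs (fs fz)) = A
fromFinSym (fs (fs (fs fz))) = N
fromFinSym (fs (fs (fs (fs fz)))) = K
fromFinSym (fs (fs (fs (fs (fs fz))))) = B
fromFinSym (fs (fs (fs (fs (fs (fs fz)))))) = E
fromFinSym (fs (fs (fs (fs (fs (fs (fs _))))))) = #

toFinSym : Sym → Fin 8
toFinSym d1 = fz
toFinSym d2 = fs fz
toFinSym A = fs (fs fz)
toFinSym N = fs (fs (fs fz))
toFinSym K = fs (fs (fs (fs fz)))
toFinSym B = fs (fs (fs (fs (fs fz))))
toFinSym E = fs (fs (fs (fs (fs (fs fz)))))
toFinSym # = fs (fs (fs (fs (fs (fs (fs fz))))))

Sym-finite : Finite Sym
Sym-finite = record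
  { size = 8 ; enc = toFinSym ; dec = fromFinSym
  ; dec-enc = λ { d1 → refl ; d2 → refl ; A → refl ; N → refl ; K → refl ; B → refl ; E → refl ; # → refl } }

symEq : Sym → Sym → Bool
symEq x y = isYes (toFinSym x FinP.≟ toFinSym y)

symEq-refl : ∀ x → symEq x x ≡ true
symEq-refl x with toFinSym x FinP.≟ toFinSym x
... | yes _ = refl
... | no ne = ⊥-elim (ne refl)

symEq-true : ∀ x y → symEq x y ≡ true → x ≡ y
symEq-true x y eq with toFinSym x FinP.≟ toFinSym y
... | yes p = trans (sym (dec-enc Sym-finite x)) (trans (cong fromFinSym p) (dec-enc Sym-finite y))
... | no _ = false≢true eq

-- The machine

-- A working cell holds an input symbol, the marks used to compare atom codes, and the
-- evaluation data of a formula node.  Status: op = not evaluated yet, val b = evaluated,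
-- new b = evaluated in the current round (its arguments get killed in the next one),
-- dead = not a node, or a value already consumed by its parent.  The flag of a □-node
-- records whether its argument held on all shorter prefixes.
data Status : Set where
  dead op : Status
  val new : Bool → Status

-- crossed: digit already compared, or model symbol already read; candidate: the code agrees
-- with the digits of the current model atom read so far; seen (on an end cell): the atom
-- occurs in the current prefix.
record Marks : Set where
  constructor marks
  field crossed candidate seen : Bool
open Marks public

record Node : Set where
  constructor node
  field flag : Bool
        status : Status
open Node public

record Cell : Set where
  constructor cell
  field symbol : Sym
        marks-of : Marks
        node-of : Node
open Cell public

-- how many arguments of the last new node the kill sweep still has to mark dead
data Pending : Set where
  k0 k1 k2 : Pending

data Match : Set where
  idle search same differ : Match

-- EV: an evaluation round; CP nothing r: fetch the next model symbol, r being the value of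
-- φ on the current prefix; CP (just s) r: compare the symbol s with every atom code.
data Phase : Set where
  EV : Phase
  CP : Maybe Sym → Bool → Phase

-- The Bool of rKill and rFetch says that # has been passed, that of lEV and lInit that it has
-- not been reached yet.  When reducing, lEV carries the
-- values of the next two roots to the right (the arguments of an operator) and of the last
-- root seen, which ends up being the value of φ; lInit carries the seen bit of the atom code
-- to the right.
data RightState : Set where
  rKill : Bool → Pending → RightState
  rFetch : Bool → Maybe Sym → RightState
  rCmp : Match → RightState

data LeftState : Set where
  lEV : Bool → Maybe Bool → Maybe Bool → Maybe Bool → LeftState
  lId : Phase → LeftState
  lInit : Bool → Bool → LeftState

data Q : Set where
  qR : Phase → Bool → RightState → Q
  qL : LeftState → Q

Status-finite : Finite Status
Status-finite = retractFinite (⊎-finite ⊤-finite (⊎-finite ⊤-finite (⊎-finite Bool-finite Bool-finite)))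
  (λ { (inj₁ _) → dead ; (inj₂ (inj₁ _)) → op ; (inj₂ (inj₂ (inj₁ b))) → val b ; (inj₂ (inj₂ (inj₂ b))) → new b })
  (λ { dead → inj₁ tt ; op → inj₂ (inj₁ tt) ; (val b) → inj₂ (inj₂ (inj₁ b)) ; (new b) → inj₂ (inj₂ (inj₂ b)) })
  (λ { dead → refl ; op → refl ; (val b) → refl ; (new b) → refl })

Marks-finite : Finite Marks
Marks-finite = retractFinite (×-finite Bool-finite (×-finite Bool-finite Bool-finite)) (λ { (a , b , c) → marks a b c })
  (λ { (marks a b c) → (a , b , c) }) (λ _ → refl)

Node-finite : Finite Node
Node-finite = retractFinite (×-finite Bool-finite Status-finite) (λ { (a , b) → node a b }) (λ { (node a b) → (a , b) }) (λ _ → refl)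

Cell-finite : Finite Cell
Cell-finite = retractFinite (×-finite Sym-finite (×-finite Marks-finite Node-finite)) (λ { (a , b , c) → cell a b c })
  (λ { (cell a b c) → (a , b , c) }) (λ _ → refl)

Pending-finite : Finite Pending
Pending-finite = retractFinite (⊎-finite ⊤-finite (⊎-finite ⊤-finite ⊤-finite))
  (λ { (inj₁ _) → k0 ; (inj₂ (inj₁ _)) → k1 ; (inj₂ (inj₂ _)) → k2 })
  (λ { k0 → inj₁ tt ; k1 → inj₂ (inj₁ tt) ; k2 → inj₂ (inj₂ tt) })
  (λ { k0 → refl ; k1 → refl ; k2 → refl })

Match-finite : Finite Match
Match-finite = retractFinite (⊎-finite ⊤-finite (⊎-finite ⊤-finite (⊎-finite ⊤-finite ⊤-finite)))
  (λ { (inj₁ _) → idle ; (inj₂ (inj₁ _)) → search ; (inj₂ (inj₂ (inj₁ _))) → same ; (inj₂ (inj₂ (inj₂ _))) → differ })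
  (λ { idle → inj₁ tt ; search → inj₂ (inj₁ tt) ; same → inj₂ (inj₂ (inj₁ tt)) ; differ → inj₂ (inj₂ (inj₂ tt)) })
  (λ { idle → refl ; search → refl ; same → refl ; differ → refl })

Phase-finite : Finite Phase
Phase-finite = retractFinite (⊎-finite ⊤-finite (×-finite (Maybe-finite Sym-finite) Bool-finite))
  (λ { (inj₁ _) → EV ; (inj₂ (m , b)) → CP m b })
  (λ { EV → inj₁ tt ; (CP m b) → inj₂ (m , b) })
  (λ { EV → refl ; (CP m b) → refl })

RightState-finite : Finite RightState
RightState-finite = retractFinite (⊎-finite (×-finite Bool-finite Pending-finite) (⊎-finite (×-finite Bool-finite (Maybe-finite Sym-finite)) Match-finite))
  (λ { (inj₁ (b , k)) → rKill b k ; (inj₂ (inj₁ (b , m))) → rFetch b m ; (inj₂ (inj₂ a)) → rCmp a })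
  (λ { (rKill b k) → inj₁ (b , k) ; (rFetch b m) → inj₂ (inj₁ (b , m)) ; (rCmp a) → inj₂ (inj₂ a) })
  (λ { (rKill b k) → refl ; (rFetch b m) → refl ; (rCmp a) → refl })

LeftState-finite : Finite LeftState
LeftState-finite = retractFinite (⊎-finite (×-finite Bool-finite (×-finite (Maybe-finite Bool-finite) (×-finite (Maybe-finite Bool-finite) (Maybe-finite Bool-finite))))
                     (⊎-finite Phase-finite (×-finite Bool-finite Bool-finite)))
  (λ { (inj₁ (a , b , c , d)) → lEV a b c d ; (inj₂ (inj₁ c)) → lId c ; (inj₂ (inj₂ (a , b))) → lInit a b })
  (λ { (lEV a b c d) → inj₁ (a , b , c , d) ; (lId c) → inj₂ (inj₁ c) ; (lInit a b) → inj₂ (inj₂ (a , b)) })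
  (λ { (lEV a b c d) → refl ; (lId c) → refl ; (lInit a b) → refl })

Q-finite : Finite Q
Q-finite = retractFinite (⊎-finite (×-finite Phase-finite (×-finite Bool-finite RightState-finite)) LeftState-finite)
  (λ { (inj₁ (c , b , r)) → qR c b r ; (inj₂ l) → qL l })
  (λ { (qR c b r) → inj₁ (c , b , r) ; (qL l) → inj₂ l })
  (λ { (qR c b r) → refl ; (qL l) → refl })

MarkedCell-finite : Finite (Bool × Cell)
MarkedCell-finite = ×-finite Bool-finite Cell-finite

isHash : Sym → Bool
isHash # = true
isHash _ = false

freshMarks : Marks
freshMarks = marks false true false

initialStatus : Sym → Status
initialStatus N = op
initialStatus K = op
initialStatus B = op
initialStatus A = val false
initialStatus _ = dead

initialCell : Sym → Cell
initialCell s = cell s freshMarks (node true (initialStatus s))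

arity : Sym → Pending
arity K = k2
arity _ = k1

killNode : Pending → Sym → Marks → Node → RightState × Cell
killNode k s c (node f (new b)) = rKill false (arity s) , cell s c (node f (val b))
killNode k1 s c (node f (val b)) = rKill false k0 , cell s c (node f dead)
killNode k2 s c (node f (val b)) = rKill false k1 , cell s c (node f dead)
killNode k s c w = rKill false k , cell s c w

killStep : Pending → Cell → RightState × Cell
killStep k (cell s c w) = if isHash s then (rKill true k , cell s c w) else killNode k s c w

fetchStep : Bool → Maybe Sym → Cell → RightState × Cell
fetchStep false f x = (if isHash (symbol x) then rFetch true f else rFetch false f) , x
fetchStep true nothing (cell s (marks false cd sn) w) = rFetch true (just s) , cell s (marks true cd sn) w
fetchStep true f x = rFetch true f , x

resetIf : Sym → Bool → Bool
resetIf E b = false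
resetIf _ b = b

isSearch : Match → Bool
isSearch search = true
isSearch _ = false

matched : Sym → Match → Bool → Bool
matched s search false = symEq E s
matched s search true = false
matched s same _ = true
matched s _ _ = false

-- On the end cell of a code the candidate bit absorbs the outcome of comparing s; when the
-- model atom ends (s = E) a surviving candidate sets seen, and the marks are reset.
endMarks : Sym → Match → Marks → Marks
endMarks E a (marks crossed cd sn) = marks false true (sn ∨ (cd ∧ matched E a crossed))
endMarks s a (marks crossed cd sn) = marks (crossed ∨ isSearch a) (cd ∧ matched s a crossed) sn

compareDigit : Sym → Match → Sym → Marks → Node → RightState × Cell
compareDigit s search x (marks false cd sn) w = rCmp (if symEq x s then same else differ) , cell x (marks (resetIf s true) cd sn) w
compareDigit s a x (marks crossed cd sn) w = rCmp a , cell x (marks (resetIf s crossed) cd sn) w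

compareStep : Sym → Match → Cell → RightState × Cell
compareStep s a (cell # c w) = rFetch true nothing , cell # c w
compareStep s a (cell A c w) = rCmp search , cell A c w
compareStep s a (cell N c w) = rCmp a , cell N c w
compareStep s a (cell K c w) = rCmp a , cell K c w
compareStep s a (cell B c w) = rCmp a , cell B c w
compareStep s a (cell d1 c w) = compareDigit s a d1 c w
compareStep s a (cell d2 c w) = compareDigit s a d2 c w
compareStep s a (cell E c w) = rCmp a , cell E (endMarks s a c) w

fetchNext : Sym → Bool → Maybe Sym → Cell → RightState × Cell
fetchNext E m f x = rFetch m f , x
fetchNext s m f x = fetchStep m f x

stepR : Phase → RightState → Cell → RightState × Cell
stepR EV (rKill false k) x = killStep k x
stepR (CP nothing r) (rFetch m f) x = fetchStep m f x
stepR (CP (just s) r) (rCmp a) x = compareStep s a x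
stepR (CP (just s) r) (rFetch m f) x = fetchNext s m f x
stepR _ rs x = rs , x

-- □ψ holds now iff ψ held on all shorter prefixes (the flag) and holds now; this is also
-- the flag for the next prefix.
reduceNode : Sym → Maybe Bool → Maybe Bool → Marks → Bool → LeftState × Cell
reduceNode N (just b) u2 c f = lEV false nothing (just b) (just (not b)) , cell N c (node f (new (not b)))
reduceNode B (just b) u2 c f = lEV false nothing (just b) (just (f ∧ b)) , cell B c (node (f ∧ b) (new (f ∧ b)))
reduceNode K (just b) (just b') c f = lEV false nothing (just b) (just (b ∧ b')) , cell K c (node f (new (b ∧ b')))
reduceNode s u1 u2 c f = lEV false nothing u1 nothing , cell s c (node f op)

reinitStep : Bool → Cell → LeftState × Cell
reinitStep sn (cell E c w) = lInit false (seen c) , cell E c (node (flag w) dead)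
reinitStep sn (cell A c w) = lInit false sn , cell A c (node (flag w) (val sn))
reinitStep sn (cell N c w) = lInit false sn , cell N c (node (flag w) op)
reinitStep sn (cell K c w) = lInit false sn , cell K c (node (flag w) op)
reinitStep sn (cell B c w) = lInit false sn , cell B c (node (flag w) op)
reinitStep sn (cell s c w) = lInit false sn , cell s c (node (flag w) dead)

stepL : LeftState → Cell → LeftState × Cell
stepL (lEV true u1 u2 lv) x = (if isHash (symbol x) then lEV false nothing nothing nothing else lEV true u1 u2 lv) , x
stepL (lEV false u1 u2 lv) (cell s c (node f dead)) = lEV false u1 u2 nothing , cell s c (node f dead)
stepL (lEV false u1 u2 lv) (cell s c (node f (val b))) = lEV false (just b) u1 (just b) , cell s c (node f (val b))
stepL (lEV false u1 u2 lv) (cell s c (node f (new b))) = lEV false nothing u1 (just b) , cell s c (node f (new b))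
stepL (lEV false u1 u2 lv) (cell s c (node f op)) = reduceNode s u1 u2 c f
stepL (lId c) x = lId c , x
stepL (lInit true sn) x = (if isHash (symbol x) then lInit false false else lInit true sn) , x
stepL (lInit false sn) x = reinitStep sn x

afterCompare : Sym → Bool → RightState → Bool ⊎ LeftState
afterCompare E r _ = inj₂ (lInit true false)
afterCompare s r (rFetch _ (just s')) = inj₂ (lId (CP (just s') r))
afterCompare s r _ = inj₁ r

afterRight : Phase → RightState → Bool ⊎ LeftState
afterRight EV _ = inj₂ (lEV true nothing nothing nothing)
afterRight (CP nothing r) (rFetch _ (just s)) = inj₂ (lId (CP (just s) r))
afterRight (CP nothing r) _ = inj₁ r
afterRight (CP (just s) r) rs = afterCompare s r rs

afterLeft : LeftState → Phase
afterLeft (lEV _ _ _ (just r)) = CP nothing r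
afterLeft (lEV _ _ _ nothing) = EV
afterLeft (lId c) = c
afterLeft (lInit _ _) = EV

initialRightState : Phase → RightState
initialRightState EV = rKill false k0
initialRightState (CP nothing r) = rFetch false nothing
initialRightState (CP (just s) r) = rCmp idle

auxCount : ℕ
auxCount = size MarkedCell-finite

TapeSym : Set
TapeSym = Γ auxCount

-- A written cell also carries a mark on the leftmost cell, where the left sweep ends;
-- an input symbol reads as its initial cell.
readCell : TapeSym → Maybe (Bool × Cell)
readCell blank = nothing
readCell (inp s) = just (false , initialCell s)
readCell (aux i) = just (dec MarkedCell-finite i)

writeCell : Bool × Cell → TapeSym
writeCell c = aux (enc MarkedCell-finite c)

encState : Q → Fin (size Q-finite)
encState = enc Q-finite

transition : Q → Maybe (Bool × Cell) → Bool ⊎ (Fin (size Q-finite) × TapeSym × Dir)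
transition (qR c f rs) nothing with afterRight c rs
... | inj₁ b = inj₁ b
... | inj₂ ls = inj₂ (encState (qL ls) , blank , L)
transition (qR c f rs) (just (lm , x)) = inj₂ (encState (qR c false (proj₁ (stepR c rs x))) , writeCell (f ∨ lm , proj₂ (stepR c rs x)) , R)
transition (qL ls) nothing = inj₁ false
transition (qL ls) (just (true , x)) =
  inj₂ (encState (qR (afterLeft (proj₁ (stepL ls x))) true (initialRightState (afterLeft (proj₁ (stepL ls x))))) , writeCell (true , proj₂ (stepL ls x)) , S)
transition (qL ls) (just (false , x)) = inj₂ (encState (qL (proj₁ (stepL ls x))) , writeCell (false , proj₂ (stepL ls x)) , L)

evaluator : TM
evaluator = record
  { states = size Q-finite
  ; extra = auxCount
  ; start = encState (qR EV true (initialRightState EV))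
  ; δ = λ q g → transition (dec Q-finite q) (readCell g) }

-- Sweeps and rounds

sweepRight : Phase → RightState → List Cell → RightState × List Cell
sweepRight c r [] = r , []
sweepRight c r (x ∷ xs) = proj₁ (sweepRight c (proj₁ (stepR c r x)) xs) , proj₂ (stepR c r x) ∷ proj₂ (sweepRight c (proj₁ (stepR c r x)) xs)

sweepLeft : LeftState → List Cell → LeftState × List Cell
sweepLeft l [] = l , []
sweepLeft l (x ∷ xs) = proj₁ (stepL (proj₁ (sweepLeft l xs)) x) , proj₂ (stepL (proj₁ (sweepLeft l xs)) x) ∷ proj₂ (sweepLeft l xs)

round : Phase → List Cell → Bool ⊎ (Phase × List Cell)
round c xs with afterRight c (proj₁ (sweepRight c (initialRightState c) xs))
... | inj₁ b = inj₁ b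
... | inj₂ l = inj₂ (afterLeft (proj₁ (sweepLeft l (proj₂ (sweepRight c (initialRightState c) xs)))) , proj₂ (sweepLeft l (proj₂ (sweepRight c (initialRightState c) xs))))

length-sweepRight : ∀ c r xs → length (proj₂ (sweepRight c r xs)) ≡ length xs
length-sweepRight c r [] = refl
length-sweepRight c r (x ∷ xs) = cong suc (length-sweepRight c _ xs)

length-sweepLeft : ∀ l xs → length (proj₂ (sweepLeft l xs)) ≡ length xs
length-sweepLeft l [] = refl
length-sweepLeft l (x ∷ xs) = cong suc (length-sweepLeft l xs)

rounds : ℕ → Phase → List Cell → Bool ⊎ (Phase × List Cell)
rounds zero c xs = inj₂ (c , xs)
rounds (suc j) c xs with round c xs
... | inj₁ b = inj₁ b
... | inj₂ (c' , ys) = rounds j c' ys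

length-round : ∀ c xs c' ys → round c xs ≡ inj₂ (c' , ys) → length ys ≡ length xs
length-round c xs c' ys eq with afterRight c (proj₁ (sweepRight c (initialRightState c) xs))
length-round c xs c' ys () | inj₁ b
length-round c xs .(afterLeft (proj₁ (sweepLeft l (proj₂ (sweepRight c (initialRightState c) xs))))) .(proj₂ (sweepLeft l (proj₂ (sweepRight c (initialRightState c) xs)))) refl | inj₂ l =
  trans (length-sweepLeft l (proj₂ (sweepRight c (initialRightState c) xs))) (length-sweepRight c (initialRightState c) xs)

sweepRight-∷ : ∀ c r x xs {r1 y r2 ys} → stepR c r x ≡ (r1 , y) → sweepRight c r1 xs ≡ (r2 , ys) → sweepRight c r (x ∷ xs) ≡ (r2 , y ∷ ys)
sweepRight-∷ c r x xs e1 e2 rewrite e1 | e2 = refl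

sweepRight-++ : ∀ c r xs ys {r1 xs' r2 ys'} → sweepRight c r xs ≡ (r1 , xs') → sweepRight c r1 ys ≡ (r2 , ys') → sweepRight c r (xs ++ ys) ≡ (r2 , xs' ++ ys')
sweepRight-++ c r [] ys refl e2 = e2
sweepRight-++ c r (x ∷ xs) ys e1 e2 with stepR c r x | sweepRight c (proj₁ (stepR c r x)) xs in e3
sweepRight-++ c r (x ∷ xs) ys refl e2 | (r0 , y) | (r1 , xs') rewrite sweepRight-++ c r0 xs ys e3 e2 = refl

sweepLeft-∷ : ∀ l x xs {l1 xs' l2 x'} → sweepLeft l xs ≡ (l1 , xs') → stepL l1 x ≡ (l2 , x') → sweepLeft l (x ∷ xs) ≡ (l2 , x' ∷ xs')
sweepLeft-∷ l x xs e1 e2 rewrite e1 | e2 = refl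

sweepLeft-++ : ∀ l xs ys {l1 ys' l2 xs'} → sweepLeft l ys ≡ (l1 , ys') → sweepLeft l1 xs ≡ (l2 , xs') → sweepLeft l (xs ++ ys) ≡ (l2 , xs' ++ ys')
sweepLeft-++ l [] ys e1 refl = e1
sweepLeft-++ l (x ∷ xs) ys {l1} {ys'} e1 e2 with sweepLeft l1 xs in e3
sweepLeft-++ l (x ∷ xs) ys {l1} {ys'} e1 e2 | (l3 , xs3) rewrite sweepLeft-++ l xs ys e1 e3 with stepL l3 x
sweepLeft-++ l (x ∷ xs) ys {l1} {ys'} e1 refl | (l3 , xs3) | (l4 , x4) = refl

round-turns : ∀ c xs {r' ys l l' zs} → sweepRight c (initialRightState c) xs ≡ (r' , ys) → afterRight c r' ≡ inj₂ l → sweepLeft l ys ≡ (l' , zs) →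
  round c xs ≡ inj₂ (afterLeft l' , zs)
round-turns c xs e1 e2 e3 rewrite e1 | e2 | e1 | e3 = refl

round-halts : ∀ c xs {r' ys b} → sweepRight c (initialRightState c) xs ≡ (r' , ys) → afterRight c r' ≡ inj₁ b → round c xs ≡ inj₁ b
round-halts c xs e1 e2 rewrite e1 | e2 = refl

rounds-step : ∀ j c xs {c' ys} → round c xs ≡ inj₂ (c' , ys) → rounds (suc j) c xs ≡ rounds j c' ys
rounds-step j c xs e rewrite e = refl

rounds-halt : ∀ j c xs {b} → round c xs ≡ inj₁ b → rounds (suc j) c xs ≡ inj₁ b
rounds-halt j c xs e rewrite e = refl

rounds-+ : ∀ a b c xs {c' ys} → rounds a c xs ≡ inj₂ (c' , ys) → rounds (a + b) c xs ≡ rounds b c' ys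
rounds-+ zero b c xs refl = refl
rounds-+ (suc a) b c xs e with round c xs
rounds-+ (suc a) b c xs () | inj₁ x
... | inj₂ (c1 , ys1) = rounds-+ a b c1 ys1 e

-- Running rounds on the machine

runE : ℕ → Config evaluator → Config evaluator
runE = run evaluator

run-+ : ∀ a b c → runE (a + b) c ≡ runE b (runE a c)
run-+ zero b c = refl
run-+ (suc a) b c = run-+ a b (step evaluator c)

run-halted : ∀ n b → runE n (halted b) ≡ halted b
run-halted zero b = refl
run-halted (suc n) b = run-halted n b

step-move : ∀ q ls h rs {q' w d} → TM.δ evaluator q h ≡ inj₂ (q' , w , d) →
  step evaluator (running q ls h rs) ≡ running q' (proj₁ (move evaluator d ls w rs)) (proj₁ (proj₂ (move evaluator d ls w rs))) (proj₂ (proj₂ (move evaluator d ls w rs)))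
step-move q ls h rs eq rewrite eq = refl

step-halt : ∀ q ls h rs {b} → TM.δ evaluator q h ≡ inj₁ b → step evaluator (running q ls h rs) ≡ halted b
step-halt q ls h rs eq rewrite eq = refl

writeUnmarked : Cell → TapeSym
writeUnmarked y = writeCell (false , y)

readCell-writeCell : ∀ p → readCell (writeCell p) ≡ just p
readCell-writeCell p = cong just (dec-enc MarkedCell-finite p)

data ReadsAs : List TapeSym → List Cell → Set where
  []  : ReadsAs [] []
  _∷_ : ∀ {g gs x xs} → readCell g ≡ just (false , x) → ReadsAs gs xs → ReadsAs (g ∷ gs) (x ∷ xs)

ReadsAs-written : ∀ xs → ReadsAs (map writeUnmarked xs) xs
ReadsAs-written [] = []
ReadsAs-written (x ∷ xs) = readCell-writeCell (false , x) ∷ ReadsAs-written xs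

data BlankTail : List TapeSym → Set where
  noBlank : BlankTail []
  oneBlank : BlankTail (blank ∷ [])

δ-right : ∀ c f r g lm x → readCell g ≡ just (lm , x) →
  TM.δ evaluator (encState (qR c f r)) g ≡ inj₂ (encState (qR c false (proj₁ (stepR c r x))) , writeCell (f ∨ lm , proj₂ (stepR c r x)) , R)
δ-right c f r g lm x eq rewrite dec-enc Q-finite (qR c f r) | eq = refl

run-sweepRight : ∀ c f r ls g lm x gs xs tl → readCell g ≡ just (lm , x) → ReadsAs gs xs → BlankTail tl →
  runE (suc (length xs)) (running (encState (qR c f r)) ls g (gs ++ tl)) ≡
  running (encState (qR c false (proj₁ (sweepRight c r (x ∷ xs)))))
          (map writeUnmarked (proj₂ (sweepRight c (proj₁ (stepR c r x)) xs)) ʳ++ writeCell (f ∨ lm , proj₂ (stepR c r x)) ∷ ls) blank []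
run-sweepRight c f r ls g lm x [] [] .[] eq [] noBlank
  rewrite step-move (encState (qR c f r)) ls g [] (δ-right c f r g lm x eq) = refl
run-sweepRight c f r ls g lm x [] [] .(blank ∷ []) eq [] oneBlank
  rewrite step-move (encState (qR c f r)) ls g (blank ∷ []) (δ-right c f r g lm x eq) = refl
run-sweepRight c f r ls g lm x (g' ∷ gs) (x' ∷ xs) tl eq (eq' ∷ dl) t
  rewrite step-move (encState (qR c f r)) ls g (g' ∷ gs ++ tl) (δ-right c f r g lm x eq) =
  run-sweepRight c false (proj₁ (stepR c r x)) (writeCell (f ∨ lm , proj₂ (stepR c r x)) ∷ ls) g' false x' gs xs tl eq' dl t

sweepLeftʳ : LeftState → List (Bool × Cell) → LeftState × List (Bool × Cell)
sweepLeftʳ l [] = l , []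
sweepLeftʳ l ((b , y) ∷ ys) = proj₁ (sweepLeftʳ (proj₁ (stepL l y)) ys) , (b , proj₂ (stepL l y)) ∷ proj₂ (sweepLeftʳ (proj₁ (stepL l y)) ys)

data LeftEndMarked : List (Bool × Cell) → Set where
  endMarked : ∀ y → LeftEndMarked ((true , y) ∷ [])
  unmarked∷ : ∀ y ps → LeftEndMarked ps → LeftEndMarked ((false , y) ∷ ps)

startConfig : Q → List TapeSym → Config evaluator
startConfig q [] = running (encState q) [] blank []
startConfig q (g ∷ gs) = running (encState q) [] g gs

roundStart : Phase → Q
roundStart c = qR c true (initialRightState c)

δ-leftEnd : ∀ l y →
  TM.δ evaluator (encState (qL l)) (writeCell (true , y)) ≡
   inj₂ (encState (roundStart (afterLeft (proj₁ (stepL l y)))) , writeCell (true , proj₂ (stepL l y)) , S)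
δ-leftEnd l y rewrite dec-enc Q-finite (qL l) | readCell-writeCell (true , y) = refl

δ-left : ∀ l y →
  TM.δ evaluator (encState (qL l)) (writeCell (false , y)) ≡
   inj₂ (encState (qL (proj₁ (stepL l y))) , writeCell (false , proj₂ (stepL l y)) , L)
δ-left l y rewrite dec-enc Q-finite (qL l) | readCell-writeCell (false , y) = refl

run-sweepLeft : ∀ l p ps rs → LeftEndMarked (p ∷ ps) →
  runE (length (p ∷ ps)) (running (encState (qL l)) (map writeCell ps) (writeCell p) rs) ≡
  startConfig (roundStart (afterLeft (proj₁ (sweepLeftʳ l (p ∷ ps))))) (map writeCell (proj₂ (sweepLeftʳ l (p ∷ ps))) ʳ++ rs)
run-sweepLeft l .(true , y) .[] rs (endMarked y) rewrite step-move (encState (qL l)) [] (writeCell (true , y)) rs (δ-leftEnd l y) = refl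
run-sweepLeft l .(false , y) .(p ∷ ps) rs (unmarked∷ y (p ∷ ps) lmr)
  rewrite step-move (encState (qL l)) (map writeCell (p ∷ ps)) (writeCell (false , y)) rs (δ-left l y) =
  run-sweepLeft (proj₁ (stepL l y)) p ps (writeCell (false , proj₂ (stepL l y)) ∷ rs) lmr

sweepLeftMarked : LeftState → List (Bool × Cell) → LeftState × List (Bool × Cell)
sweepLeftMarked l [] = l , []
sweepLeftMarked l ((b , y) ∷ ys) = proj₁ (stepL (proj₁ (sweepLeftMarked l ys)) y) , (b , proj₂ (stepL (proj₁ (sweepLeftMarked l ys)) y)) ∷ proj₂ (sweepLeftMarked l ys)

unmarked : Cell → Bool × Cell
unmarked y = (false , y)

sweepLeftMarked-unmarked : ∀ l ys → sweepLeftMarked l (map unmarked ys) ≡ (proj₁ (sweepLeft l ys) , map unmarked (proj₂ (sweepLeft l ys)))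
sweepLeftMarked-unmarked l [] = refl
sweepLeftMarked-unmarked l (y ∷ ys) rewrite sweepLeftMarked-unmarked l ys = refl

sweepLeftʳ-ʳ++ : ∀ l T acc → sweepLeftʳ l (T ʳ++ acc) ≡
  (proj₁ (sweepLeftʳ (proj₁ (sweepLeftMarked l T)) acc) , proj₂ (sweepLeftMarked l T) ʳ++ proj₂ (sweepLeftʳ (proj₁ (sweepLeftMarked l T)) acc))
sweepLeftʳ-ʳ++ l [] acc = refl
sweepLeftʳ-ʳ++ l ((b , y) ∷ T) acc rewrite sweepLeftʳ-ʳ++ l T ((b , y) ∷ acc) = refl

LeftEndMarked-ʳ++ : ∀ ys acc → LeftEndMarked acc → LeftEndMarked (map unmarked ys ʳ++ acc)
LeftEndMarked-ʳ++ [] acc l = l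
LeftEndMarked-ʳ++ (y ∷ ys) acc l = LeftEndMarked-ʳ++ ys ((false , y) ∷ acc) (unmarked∷ y acc l)

writeUnmarked-ʳ++ : ∀ ys acc → map writeUnmarked ys ʳ++ map writeCell acc ≡ map writeCell (map unmarked ys ʳ++ acc)
writeUnmarked-ʳ++ [] acc = refl
writeUnmarked-ʳ++ (y ∷ ys) acc = writeUnmarked-ʳ++ ys ((false , y) ∷ acc)

δ-turn : ∀ c f r l → afterRight c r ≡ inj₂ l → TM.δ evaluator (encState (qR c f r)) blank ≡ inj₂ (encState (qL l) , blank , L)
δ-turn c f r l eq rewrite dec-enc Q-finite (qR c f r) | eq = refl

δ-halt : ∀ c f r b → afterRight c r ≡ inj₁ b → TM.δ evaluator (encState (qR c f r)) blank ≡ inj₁ b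
δ-halt c f r b eq rewrite dec-enc Q-finite (qR c f r) | eq = refl

run-turn : ∀ l P q → LeftEndMarked P → TM.δ evaluator (encState q) blank ≡ inj₂ (encState (qL l) , blank , L) →
  runE (suc (length P)) (running (encState q) (map writeCell P) blank []) ≡
  startConfig (roundStart (afterLeft (proj₁ (sweepLeftʳ l P)))) (map writeCell (proj₂ (sweepLeftʳ l P)) ʳ++ blank ∷ [])
run-turn l .((true , y) ∷ []) q (endMarked y) eq
  rewrite step-move (encState q) (map writeCell ((true , y) ∷ [])) blank [] eq = run-sweepLeft l (true , y) [] (blank ∷ []) (endMarked y)
run-turn l .((false , y) ∷ ps) q (unmarked∷ y ps lmr) eq
  rewrite step-move (encState q) (map writeCell ((false , y) ∷ ps)) blank [] eq = run-sweepLeft l (false , y) ps (blank ∷ []) (unmarked∷ y ps lmr)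

roundConfig : Bool ⊎ (Phase × List Cell) → Config evaluator
roundConfig (inj₁ b) = halted b
roundConfig (inj₂ (c' , [])) = halted false
roundConfig (inj₂ (c' , z ∷ zs)) = running (encState (roundStart c')) [] (writeCell (true , z)) (map writeUnmarked zs ++ blank ∷ [])

roundConfig-turn : ∀ c' z zs → startConfig (roundStart c') (map writeCell (((true , z) ∷ map unmarked zs) ʳ++ []) ʳ++ blank ∷ []) ≡
   running (encState (roundStart c')) [] (writeCell (true , z)) (map writeUnmarked zs ++ blank ∷ [])
roundConfig-turn c' z zs
  rewrite LP.map-ʳ++ writeCell ((true , z) ∷ map unmarked zs) {[]}
        | LP.ʳ++-ʳ++ (map writeCell ((true , z) ∷ map unmarked zs)) {[]} {blank ∷ []}
        | LP.map-∘ {g = writeCell} {unmarked} zs = refl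

roundTime : ℕ → ℕ
roundTime n = suc n + suc (suc n)

run-round : ∀ c g lm x gs xs tl → readCell g ≡ just (lm , x) → ReadsAs gs xs → BlankTail tl →
  runE (roundTime (length xs)) (running (encState (roundStart c)) [] g (gs ++ tl)) ≡ roundConfig (round c (x ∷ xs))
run-round c g lm x gs xs tl g↦x gs↦xs tail
  rewrite run-+ (suc (length xs)) (suc (suc (length xs))) (running (encState (roundStart c)) [] g (gs ++ tl))
        | run-sweepRight c true (initialRightState c) [] g lm x gs xs tl g↦x gs↦xs tail
  with afterRight c (proj₁ (sweepRight c (initialRightState c) (x ∷ xs))) in eR
... | inj₁ b = trans (cong (runE (suc (length xs))) (step-halt _ _ blank [] (δ-halt c false _ b eR))) (run-halted (suc (length xs)) b)
... | inj₂ l = begin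
    runE (suc (suc (length xs))) (running (encState q) (map writeUnmarked ys ʳ++ writeCell (true , y0) ∷ []) blank [])
      ≡⟨ cong (λ z → runE (suc (suc (length xs))) (running (encState q) z blank [])) (writeUnmarked-ʳ++ ys ((true , y0) ∷ [])) ⟩
    runE (suc (suc (length xs))) (running (encState q) (map writeCell P) blank [])
      ≡⟨ cong (λ m → runE (suc m) (running (encState q) (map writeCell P) blank [])) (sym length-P) ⟩
    runE (suc (length P)) (running (encState q) (map writeCell P) blank [])
      ≡⟨ run-turn l P q (LeftEndMarked-ʳ++ ys ((true , y0) ∷ []) (endMarked y0)) (δ-turn c false _ l eR) ⟩
    startConfig (roundStart (afterLeft (proj₁ (sweepLeftʳ l P)))) (map writeCell (proj₂ (sweepLeftʳ l P)) ʳ++ blank ∷ [])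
      ≡⟨ turned ⟩
    roundConfig (inj₂ (afterLeft (proj₁ (sweepLeft l (y0 ∷ ys))) , proj₂ (sweepLeft l (y0 ∷ ys)))) ∎
  where
  open ≡-Reasoning
  q = qR c false (proj₁ (sweepRight c (initialRightState c) (x ∷ xs)))
  y0 = proj₂ (stepR c (initialRightState c) x)
  ys = proj₂ (sweepRight c (proj₁ (stepR c (initialRightState c) x)) xs)
  P = map unmarked ys ʳ++ (true , y0) ∷ []
  length-P : length P ≡ suc (length xs)
  length-P = trans (LP.length-ʳ++ (map unmarked ys) {(true , y0) ∷ []})
    (trans (NP.+-comm (length (map unmarked ys)) 1)
           (cong suc (trans (LP.length-map unmarked ys) (length-sweepRight c _ xs))))
  turned : startConfig (roundStart (afterLeft (proj₁ (sweepLeftʳ l P)))) (map writeCell (proj₂ (sweepLeftʳ l P)) ʳ++ blank ∷ [])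
         ≡ roundConfig (inj₂ (afterLeft (proj₁ (sweepLeft l (y0 ∷ ys))) , proj₂ (sweepLeft l (y0 ∷ ys))))
  turned rewrite sweepLeftʳ-ʳ++ l ((true , y0) ∷ map unmarked ys) [] | sweepLeftMarked-unmarked l ys =
    roundConfig-turn (afterLeft (proj₁ (sweepLeft l (y0 ∷ ys)))) _ (proj₂ (sweepLeft l ys))

run-rounds : ∀ j c g lm x gs xs tl b → readCell g ≡ just (lm , x) → ReadsAs gs xs → BlankTail tl → rounds j c (x ∷ xs) ≡ inj₁ b →
  runE (j * roundTime (length xs)) (running (encState (roundStart c)) [] g (gs ++ tl)) ≡ halted b
run-rounds zero c g lm x gs xs tl b eq dl t ()
run-rounds (suc j) c g lm x gs xs tl b eq dl t it
  rewrite run-+ (roundTime (length xs)) (j * roundTime (length xs)) (running (encState (roundStart c)) [] g (gs ++ tl))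
        | run-round c g lm x gs xs tl eq dl t
  with round c (x ∷ xs) in er
run-rounds (suc j) c g lm x gs xs tl b eq dl t refl | inj₁ b' = run-halted (j * roundTime (length xs)) b'
run-rounds (suc j) c g lm x gs xs tl b eq dl t it | inj₂ (c' , []) with length-round c (x ∷ xs) c' [] er
... | ()
run-rounds (suc j) c g lm x gs xs tl b eq dl t it | inj₂ (c' , z ∷ zs) with length-round c (x ∷ xs) c' (z ∷ zs) er
... | lenEq = subst (λ m → runE (j * roundTime m) (running (encState (roundStart c')) [] (writeCell (true , z)) (map writeUnmarked zs ++ blank ∷ [])) ≡ halted b)
                 (NP.suc-injective lenEq)
                 (run-rounds j c' (writeCell (true , z)) true z (map writeUnmarked zs) zs (blank ∷ []) b (readCell-writeCell (true , z)) (ReadsAs-written zs) oneBlank it)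

ReadsAs-input : ∀ ss → ReadsAs (map inp ss) (map initialCell ss)
ReadsAs-input [] = []
ReadsAs-input (s ∷ ss) = refl ∷ ReadsAs-input ss

run-evaluator : ∀ s ss n b → rounds n EV (map initialCell (s ∷ ss)) ≡ inj₁ b →
  HaltsWithin evaluator (s ∷ ss) (n * roundTime (length ss)) b
run-evaluator s ss n b halts =
  trans (cong (λ tl → runE (n * roundTime (length ss)) (running (encState (roundStart EV)) [] (inp s) tl)) (sym (LP.++-identityʳ (map inp ss))))
        (subst (λ m → runE (n * roundTime m) (running (encState (roundStart EV)) [] (inp s) (map inp ss ++ [])) ≡ halted b)
               (LP.length-map initialCell ss)
               (run-rounds n EV (inp s) false (initialCell s) (map inp ss) (map initialCell ss) [] b refl (ReadsAs-input ss) noBlank halts))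

-- Heights and atom codes

-- unlike Data.Nat's _≤ᵇ_, leB (suc m) (suc n) reduces to leB m n
leB : ℕ → ℕ → Bool
leB zero n = true
leB (suc m) zero = false
leB (suc m) (suc n) = leB m n

height : Fml → ℕ
height (atom a) = 0
height (¬' ψ) = suc (height ψ)
height (φ ∧' ψ) = suc (height φ ⊔ height ψ)
height (□ ψ) = suc (height ψ)

leB-suc : ∀ m i → leB m i ≡ true → leB m (suc i) ≡ true
leB-suc zero i e = refl
leB-suc (suc m) (suc i) e = leB-suc m i e

leB-⊔ : ∀ m n i → leB (m ⊔ n) i ≡ true → (leB m i ≡ true) × (leB n i ≡ true)
leB-⊔ zero zero i e = refl , refl
leB-⊔ zero (suc n) i e = refl , e
leB-⊔ (suc m) zero i e = e , refl
leB-⊔ (suc m) (suc n) (suc i) e = leB-⊔ m n i e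

leB-sucˡ : ∀ m i → leB (suc m) i ≡ true → leB m i ≡ true
leB-sucˡ zero i e = refl
leB-sucˡ (suc m) (suc i) e = leB-sucˡ m i e

leB-⊔f : ∀ m n i → leB (m ⊔ n) i ≡ false → leB m i ≡ true → leB n i ≡ false
leB-⊔f zero zero i () e2
leB-⊔f zero (suc n) i e1 e2 = e1
leB-⊔f (suc m) zero (suc i) e1 e2 = false≢true (trans (sym e1) e2)
leB-⊔f (suc m) (suc n) (suc i) e1 e2 = leB-⊔f m n i e1 e2

leB-false-pred : ∀ m i → leB m (suc i) ≡ false → leB m i ≡ false
leB-false-pred m i e with leB m i in e'
... | false = refl
... | true = false≢true (trans (sym e) (leB-suc m i e'))

leB-suc+ : ∀ n i → leB (suc (n + i)) i ≡ false
leB-suc+ n zero = refl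
leB-suc+ n (suc i) rewrite NP.+-suc n i = leB-suc+ n i

leB-refl : ∀ n → leB n n ≡ true
leB-refl zero = refl
leB-refl (suc n) = leB-refl n

leB-pred : ∀ n → leB n (suc (n ∸ 1)) ≡ true
leB-pred zero = refl
leB-pred (suc n) = leB-refl n

≢# : Sym → Set
≢# s = isHash s ≡ false

digits : ℕ → List Sym
digits a = encBin (fromℕ a)

startsWith : List Sym → List Sym → Bool
startsWith code [] = true
startsWith [] (s ∷ w) = false
startsWith (x ∷ xs) (s ∷ w) = symEq x s ∧ startsWith xs w

digitCell : Sym → Bool → Cell
digitCell x b = cell x (marks b true false) (node true dead)

digitCells : List Sym → List Sym → List Cell
digitCells [] w = []
digitCells (x ∷ xs) [] = digitCell x false ∷ digitCells xs []
digitCells (x ∷ xs) (y ∷ w) = digitCell x true ∷ digitCells xs w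

overrun : List Sym → List Sym → Bool
overrun [] [] = false
overrun [] (_ ∷ _) = true
overrun (x ∷ xs) [] = false
overrun (x ∷ xs) (y ∷ w) = overrun xs w

endCell : Bool → Bool → Bool → Cell
endCell crossed cd sn = cell E (marks crossed cd sn) (node true dead)

codeCells : List Sym → List Sym → Bool → Bool → List Cell
codeCells ds w cd sn = digitCells ds w ++ endCell (overrun ds w) cd sn ∷ []

sweepRight-digitCells : ∀ c r → (∀ bb → stepR c r (digitCell d1 bb) ≡ (r , digitCell d1 bb)) → (∀ bb → stepR c r (digitCell d2 bb) ≡ (r , digitCell d2 bb)) →
  ∀ b w → sweepRight c r (digitCells (encBin b) w) ≡ (r , digitCells (encBin b) w)
sweepRight-digitCells c r h1 h2 zeroᵇ w = refl
sweepRight-digitCells c r h1 h2 2[1+ b ] [] = sweepRight-∷ c r (digitCell d2 false) (digitCells (encBin b) []) (h2 false) (sweepRight-digitCells c r h1 h2 b [])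
sweepRight-digitCells c r h1 h2 2[1+ b ] (y ∷ w) = sweepRight-∷ c r (digitCell d2 true) (digitCells (encBin b) w) (h2 true) (sweepRight-digitCells c r h1 h2 b w)
sweepRight-digitCells c r h1 h2 1+[2 b ] [] = sweepRight-∷ c r (digitCell d1 false) (digitCells (encBin b) []) (h1 false) (sweepRight-digitCells c r h1 h2 b [])
sweepRight-digitCells c r h1 h2 1+[2 b ] (y ∷ w) = sweepRight-∷ c r (digitCell d1 true) (digitCells (encBin b) w) (h1 true) (sweepRight-digitCells c r h1 h2 b w)

sweepLeft-digitCells : ∀ l → (∀ bb → stepL l (digitCell d1 bb) ≡ (l , digitCell d1 bb)) → (∀ bb → stepL l (digitCell d2 bb) ≡ (l , digitCell d2 bb)) →
  ∀ b w → sweepLeft l (digitCells (encBin b) w) ≡ (l , digitCells (encBin b) w)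
sweepLeft-digitCells l h1 h2 zeroᵇ w = refl
sweepLeft-digitCells l h1 h2 2[1+ b ] [] = sweepLeft-∷ l (digitCell d2 false) (digitCells (encBin b) []) (sweepLeft-digitCells l h1 h2 b []) (h2 false)
sweepLeft-digitCells l h1 h2 2[1+ b ] (y ∷ w) = sweepLeft-∷ l (digitCell d2 true) (digitCells (encBin b) w) (sweepLeft-digitCells l h1 h2 b w) (h2 true)
sweepLeft-digitCells l h1 h2 1+[2 b ] [] = sweepLeft-∷ l (digitCell d1 false) (digitCells (encBin b) []) (sweepLeft-digitCells l h1 h2 b []) (h1 false)
sweepLeft-digitCells l h1 h2 1+[2 b ] (y ∷ w) = sweepLeft-∷ l (digitCell d1 true) (digitCells (encBin b) w) (sweepLeft-digitCells l h1 h2 b w) (h1 true)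

reduce-codeCells : ∀ b w cd sn u1 u2 lv → sweepLeft (lEV false u1 u2 lv) (codeCells (encBin b) w cd sn) ≡ (lEV false u1 u2 nothing , codeCells (encBin b) w cd sn)
reduce-codeCells b w cd sn u1 u2 lv =
  sweepLeft-++ (lEV false u1 u2 lv) (digitCells (encBin b) w) _ refl (sweepLeft-digitCells (lEV false u1 u2 nothing) (λ _ → refl) (λ _ → refl) b w)

kill-codeCells : ∀ b w cd sn kk → sweepRight EV (rKill false kk) (codeCells (encBin b) w cd sn) ≡ (rKill false kk , codeCells (encBin b) w cd sn)
kill-codeCells b w cd sn kk = sweepRight-++ EV (rKill false kk) (digitCells (encBin b) w) _ (sweepRight-digitCells EV (rKill false kk) (λ _ → refl) (λ _ → refl) b w) refl

fetch-codeCells : ∀ b w cd sn r f → sweepRight (CP nothing r) (rFetch false f) (codeCells (encBin b) w cd sn) ≡ (rFetch false f , codeCells (encBin b) w cd sn)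
fetch-codeCells b w cd sn r f = sweepRight-++ (CP nothing r) (rFetch false f) (digitCells (encBin b) w) _ (sweepRight-digitCells (CP nothing r) (rFetch false f) (λ _ → refl) (λ _ → refl) b w) refl

reinit-codeCells : ∀ b w cd sn sn0 → sweepLeft (lInit false sn0) (codeCells (encBin b) w cd sn) ≡ (lInit false sn , codeCells (encBin b) w cd sn)
reinit-codeCells b w cd sn sn0 = sweepLeft-++ (lInit false sn0) (digitCells (encBin b) w) _ refl (sweepLeft-digitCells (lInit false sn) (λ _ → refl) (λ _ → refl) b w)

sweepLeft-lId : ∀ c xs → sweepLeft (lId c) xs ≡ (lId c , xs)
sweepLeft-lId c [] = refl
sweepLeft-lId c (x ∷ xs) = sweepLeft-∷ (lId c) x xs (sweepLeft-lId c xs) refl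

data Digit : Sym → Set where
  digit1 : Digit d1
  digit2 : Digit d2

matchOutcome : List Sym → List Sym → Sym → Match
matchOutcome [] w s = search
matchOutcome (x ∷ xs) [] s = if symEq x s then same else differ
matchOutcome (x ∷ xs) (y ∷ w) s = matchOutcome xs w s

compare-digitCells-decided : ∀ s → Digit s → ∀ a → isSearch a ≡ false → ∀ r b w → sweepRight (CP (just s) r) (rCmp a) (digitCells (encBin b) w) ≡ (rCmp a , digitCells (encBin b) w)
compare-digitCells-decided s ds a ns r = sweepRight-digitCells (CP (just s) r) (rCmp a) (fixes-d1 s ds a ns) (fixes-d2 s ds a ns)
  where
  fixes-d1 : ∀ s → Digit s → ∀ a → isSearch a ≡ false → ∀ bb → stepR (CP (just s) r) (rCmp a) (digitCell d1 bb) ≡ (rCmp a , digitCell d1 bb)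
  fixes-d1 .d1 digit1 idle e bb = refl
  fixes-d1 .d1 digit1 same e bb = refl
  fixes-d1 .d1 digit1 differ e bb = refl
  fixes-d1 .d2 digit2 idle e bb = refl
  fixes-d1 .d2 digit2 same e bb = refl
  fixes-d1 .d2 digit2 differ e bb = refl
  fixes-d2 : ∀ s → Digit s → ∀ a → isSearch a ≡ false → ∀ bb → stepR (CP (just s) r) (rCmp a) (digitCell d2 bb) ≡ (rCmp a , digitCell d2 bb)
  fixes-d2 .d1 digit1 idle e bb = refl
  fixes-d2 .d1 digit1 same e bb = refl
  fixes-d2 .d1 digit1 differ e bb = refl
  fixes-d2 .d2 digit2 idle e bb = refl
  fixes-d2 .d2 digit2 same e bb = refl
  fixes-d2 .d2 digit2 differ e bb = refl

isSearch-same/differ : ∀ c → isSearch (if c then same else differ) ≡ false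
isSearch-same/differ true = refl
isSearch-same/differ false = refl

compare-digitCells : ∀ s → Digit s → ∀ r b w → sweepRight (CP (just s) r) (rCmp search) (digitCells (encBin b) w) ≡
   (rCmp (matchOutcome (encBin b) w s) , digitCells (encBin b) (w ∷ʳ s))
compare-digitCells s ds r zeroᵇ w = refl
compare-digitCells .d1 digit1 r 2[1+ b ] [] = sweepRight-∷ (CP (just d1) r) (rCmp search) (digitCell d2 false) (digitCells (encBin b) []) refl (compare-digitCells-decided d1 digit1 _ (isSearch-same/differ (symEq d2 d1)) r b [])
compare-digitCells .d2 digit2 r 2[1+ b ] [] = sweepRight-∷ (CP (just d2) r) (rCmp search) (digitCell d2 false) (digitCells (encBin b) []) refl (compare-digitCells-decided d2 digit2 _ (isSearch-same/differ (symEq d2 d2)) r b [])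
compare-digitCells .d1 digit1 r 1+[2 b ] [] = sweepRight-∷ (CP (just d1) r) (rCmp search) (digitCell d1 false) (digitCells (encBin b) []) refl (compare-digitCells-decided d1 digit1 _ (isSearch-same/differ (symEq d1 d1)) r b [])
compare-digitCells .d2 digit2 r 1+[2 b ] [] = sweepRight-∷ (CP (just d2) r) (rCmp search) (digitCell d1 false) (digitCells (encBin b) []) refl (compare-digitCells-decided d2 digit2 _ (isSearch-same/differ (symEq d1 d2)) r b [])
compare-digitCells .d1 digit1 r 2[1+ b ] (y ∷ w) = sweepRight-∷ (CP (just d1) r) (rCmp search) (digitCell d2 true) (digitCells (encBin b) w) refl (compare-digitCells d1 digit1 r b w)
compare-digitCells .d2 digit2 r 2[1+ b ] (y ∷ w) = sweepRight-∷ (CP (just d2) r) (rCmp search) (digitCell d2 true) (digitCells (encBin b) w) refl (compare-digitCells d2 digit2 r b w)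
compare-digitCells .d1 digit1 r 1+[2 b ] (y ∷ w) = sweepRight-∷ (CP (just d1) r) (rCmp search) (digitCell d1 true) (digitCells (encBin b) w) refl (compare-digitCells d1 digit1 r b w)
compare-digitCells .d2 digit2 r 1+[2 b ] (y ∷ w) = sweepRight-∷ (CP (just d2) r) (rCmp search) (digitCell d1 true) (digitCells (encBin b) w) refl (compare-digitCells d2 digit2 r b w)

sweepRight-digitCells-uncross : ∀ c r → (∀ bb → stepR c r (digitCell d1 bb) ≡ (r , digitCell d1 false)) → (∀ bb → stepR c r (digitCell d2 bb) ≡ (r , digitCell d2 false)) →
  ∀ b w → sweepRight c r (digitCells (encBin b) w) ≡ (r , digitCells (encBin b) [])
sweepRight-digitCells-uncross c r h1 h2 zeroᵇ w = refl
sweepRight-digitCells-uncross c r h1 h2 2[1+ b ] [] = sweepRight-∷ c r (digitCell d2 false) (digitCells (encBin b) []) (h2 false) (sweepRight-digitCells-uncross c r h1 h2 b [])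
sweepRight-digitCells-uncross c r h1 h2 2[1+ b ] (y ∷ w) = sweepRight-∷ c r (digitCell d2 true) (digitCells (encBin b) w) (h2 true) (sweepRight-digitCells-uncross c r h1 h2 b w)
sweepRight-digitCells-uncross c r h1 h2 1+[2 b ] [] = sweepRight-∷ c r (digitCell d1 false) (digitCells (encBin b) []) (h1 false) (sweepRight-digitCells-uncross c r h1 h2 b [])
sweepRight-digitCells-uncross c r h1 h2 1+[2 b ] (y ∷ w) = sweepRight-∷ c r (digitCell d1 true) (digitCells (encBin b) w) (h1 true) (sweepRight-digitCells-uncross c r h1 h2 b w)

compare-digitCells-decided-last : ∀ a → isSearch a ≡ false → ∀ r b w → sweepRight (CP (just E) r) (rCmp a) (digitCells (encBin b) w) ≡ (rCmp a , digitCells (encBin b) [])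
compare-digitCells-decided-last idle _ r = sweepRight-digitCells-uncross (CP (just E) r) (rCmp idle) (λ _ → refl) (λ _ → refl)
compare-digitCells-decided-last same _ r = sweepRight-digitCells-uncross (CP (just E) r) (rCmp same) (λ _ → refl) (λ _ → refl)
compare-digitCells-decided-last differ _ r = sweepRight-digitCells-uncross (CP (just E) r) (rCmp differ) (λ _ → refl) (λ _ → refl)

compare-digitCells-last : ∀ r b w → sweepRight (CP (just E) r) (rCmp search) (digitCells (encBin b) w) ≡
   (rCmp (matchOutcome (encBin b) w E) , digitCells (encBin b) [])
compare-digitCells-last r zeroᵇ w = refl
compare-digitCells-last r 2[1+ b ] [] = sweepRight-∷ (CP (just E) r) (rCmp search) (digitCell d2 false) (digitCells (encBin b) []) refl (compare-digitCells-decided-last _ (isSearch-same/differ (symEq d2 E)) r b [])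
compare-digitCells-last r 1+[2 b ] [] = sweepRight-∷ (CP (just E) r) (rCmp search) (digitCell d1 false) (digitCells (encBin b) []) refl (compare-digitCells-decided-last _ (isSearch-same/differ (symEq d1 E)) r b [])
compare-digitCells-last r 2[1+ b ] (y ∷ w) = sweepRight-∷ (CP (just E) r) (rCmp search) (digitCell d2 true) (digitCells (encBin b) w) refl (compare-digitCells-last r b w)
compare-digitCells-last r 1+[2 b ] (y ∷ w) = sweepRight-∷ (CP (just E) r) (rCmp search) (digitCell d1 true) (digitCells (encBin b) w) refl (compare-digitCells-last r b w)

overrun-[] : ∀ ds → overrun ds [] ≡ false
overrun-[] [] = refl
overrun-[] (x ∷ ds) = refl

overrun-∷ʳ : ∀ ds w s → (overrun ds w ∨ isSearch (matchOutcome ds w s)) ≡ overrun ds (w ∷ʳ s)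
overrun-∷ʳ [] [] s = refl
overrun-∷ʳ [] (y ∷ w) s = refl
overrun-∷ʳ (x ∷ ds) [] s rewrite isSearch-same/differ (symEq x s) | overrun-[] ds = refl
overrun-∷ʳ (x ∷ ds) (y ∷ w) s = overrun-∷ʳ ds w s

startsWith-[]-∷ʳ : ∀ w s → startsWith [] (w ∷ʳ s) ≡ false
startsWith-[]-∷ʳ [] s = refl
startsWith-[]-∷ʳ (y ∷ w) s = refl

startsWith-∷ʳ : ∀ ds w s → (startsWith (ds ++ E ∷ []) w ∧ matched s (matchOutcome ds w s) (overrun ds w)) ≡ startsWith (ds ++ E ∷ []) (w ∷ʳ s)
startsWith-∷ʳ [] [] s = sym (∧-identityʳ (symEq E s))
startsWith-∷ʳ [] (y ∷ w) s rewrite startsWith-[]-∷ʳ w s | ∧-zeroʳ (startsWith (E ∷ []) (y ∷ w)) = sym (∧-zeroʳ (symEq E y))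
startsWith-∷ʳ (x ∷ ds) [] s with symEq x s
... | true = refl
... | false = refl
startsWith-∷ʳ (x ∷ ds) (y ∷ w) s rewrite ∧-assoc (symEq x y) (startsWith (ds ++ E ∷ []) w) (matched s (matchOutcome ds w s) (overrun ds w)) | startsWith-∷ʳ ds w s = refl

compare-codeCells : ∀ s → Digit s → ∀ r b w sn →
  sweepRight (CP (just s) r) (rCmp search) (codeCells (encBin b) w (startsWith (encBin b ++ E ∷ []) w) sn) ≡
  (rCmp (matchOutcome (encBin b) w s) , codeCells (encBin b) (w ∷ʳ s) (startsWith (encBin b ++ E ∷ []) (w ∷ʳ s)) sn)
compare-codeCells s ds r b w sn = sweepRight-++ (CP (just s) r) (rCmp search) (digitCells (encBin b) w) _ (compare-digitCells s ds r b w) (sweepRight-∷ (CP (just s) r) (rCmp (matchOutcome (encBin b) w s)) (endCell (overrun (encBin b) w) (startsWith (encBin b ++ E ∷ []) w) sn) [] (h s ds) refl)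
  where
  h : ∀ s → Digit s → stepR (CP (just s) r) (rCmp (matchOutcome (encBin b) w s)) (endCell (overrun (encBin b) w) (startsWith (encBin b ++ E ∷ []) w) sn)
        ≡ (rCmp (matchOutcome (encBin b) w s) , endCell (overrun (encBin b) (w ∷ʳ s)) (startsWith (encBin b ++ E ∷ []) (w ∷ʳ s)) sn)
  h .d1 digit1 rewrite overrun-∷ʳ (encBin b) w d1 | startsWith-∷ʳ (encBin b) w d1 = refl
  h .d2 digit2 rewrite overrun-∷ʳ (encBin b) w d2 | startsWith-∷ʳ (encBin b) w d2 = refl

compare-codeCells-last : ∀ r b w cd sn → cd ≡ startsWith (encBin b ++ E ∷ []) w →
  sweepRight (CP (just E) r) (rCmp search) (codeCells (encBin b) w cd sn) ≡
  (rCmp (matchOutcome (encBin b) w E) , codeCells (encBin b) [] true (sn ∨ startsWith (encBin b ++ E ∷ []) (w ∷ʳ E)))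
compare-codeCells-last r b w cd sn refl = sweepRight-++ (CP (just E) r) (rCmp search) (digitCells (encBin b) w) _ (compare-digitCells-last r b w) (sweepRight-∷ (CP (just E) r) (rCmp (matchOutcome (encBin b) w E)) (endCell (overrun (encBin b) w) (startsWith (encBin b ++ E ∷ []) w) sn) [] h refl)
  where
  h : stepR (CP (just E) r) (rCmp (matchOutcome (encBin b) w E)) (endCell (overrun (encBin b) w) (startsWith (encBin b ++ E ∷ []) w) sn)
        ≡ (rCmp (matchOutcome (encBin b) w E) , endCell (overrun (encBin b) []) true (sn ∨ startsWith (encBin b ++ E ∷ []) (w ∷ʳ E)))
  h rewrite overrun-[] (encBin b) | sym (startsWith-∷ʳ (encBin b) w E) = refl

encBin-digits : ∀ b → All Digit (encBin b)
encBin-digits zeroᵇ = []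
encBin-digits 2[1+ b ] = digit2 ∷ encBin-digits b
encBin-digits 1+[2 b ] = digit1 ∷ encBin-digits b

encBin-injective : ∀ b b' → encBin b ≡ encBin b' → b ≡ b'
encBin-injective zeroᵇ zeroᵇ e = refl
encBin-injective zeroᵇ 2[1+ b' ] ()
encBin-injective zeroᵇ 1+[2 b' ] ()
encBin-injective 2[1+ b ] zeroᵇ ()
encBin-injective 2[1+ b ] 2[1+ b' ] e = cong 2[1+_] (encBin-injective b b' (LP.∷-injectiveʳ e))
encBin-injective 2[1+ b ] 1+[2 b' ] ()
encBin-injective 1+[2 b ] zeroᵇ ()
encBin-injective 1+[2 b ] 2[1+ b' ] ()
encBin-injective 1+[2 b ] 1+[2 b' ] e = cong 1+[2_] (encBin-injective b b' (LP.∷-injectiveʳ e))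

digits-injective : ∀ a m → digits a ≡ digits m → a ≡ m
digits-injective a m e = trans (sym (BinP.toℕ-fromℕ a)) (trans (cong toℕ (encBin-injective _ _ e)) (BinP.toℕ-fromℕ m))

startsWith-refl : ∀ xs → startsWith xs xs ≡ true
startsWith-refl [] = refl
startsWith-refl (x ∷ xs) rewrite symEq-refl x = startsWith-refl xs

∧-true⁻ : ∀ a b → (a ∧ b) ≡ true → (a ≡ true) × (b ≡ true)
∧-true⁻ true true e = refl , refl

startsWith-codes : ∀ ds ds' → All Digit ds → All Digit ds' → startsWith (ds ++ E ∷ []) (ds' ++ E ∷ []) ≡ true → ds ≡ ds'
startsWith-codes [] [] p q e = refl
startsWith-codes [] (.d1 ∷ ds') p (digit1 ∷ q) ()
startsWith-codes [] (.d2 ∷ ds') p (digit2 ∷ q) ()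
startsWith-codes (.d1 ∷ ds) [] (digit1 ∷ p) q ()
startsWith-codes (.d2 ∷ ds) [] (digit2 ∷ p) q ()
startsWith-codes (x ∷ ds) (y ∷ ds') (dx ∷ p) (dy ∷ q) e with ∧-true⁻ (symEq x y) _ e
... | (e1 , e2) = cong₂ _∷_ (symEq-true x y e1) (startsWith-codes ds ds' p q e2)

startsWith-encAtom : ∀ a m → startsWith (encAtom a) (encAtom m) ≡ isYes (a ≟ m)
startsWith-encAtom a m with a ≟ m
... | yes refl = startsWith-refl (encAtom a)
... | no ne with startsWith (encAtom a) (encAtom m) in e
...   | false = refl
...   | true = ⊥-elim (ne (digits-injective a m (startsWith-codes (digits a) (digits m) (encBin-digits (fromℕ a)) (encBin-digits (fromℕ m)) e)))

data CodeSplit (m : ℕ) (w : List Sym) (s : Sym) (u : List Sym) : Set where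
  atEnd : s ≡ E → u ≡ [] → w ≡ digits m → CodeSplit m w s u
  atDigit : Digit s → (∃ λ s' → ∃ λ u' → u ≡ s' ∷ u') → CodeSplit m w s u

splitCode′ : ∀ ds w s u → All Digit ds → ds ++ E ∷ [] ≡ w ++ s ∷ u →
  (s ≡ E × u ≡ [] × w ≡ ds) ⊎ (Digit s × (∃ λ s' → ∃ λ u' → u ≡ s' ∷ u'))
splitCode′ [] [] .E .[] p refl = inj₁ (refl , refl , refl)
splitCode′ [] (x ∷ []) s u p ()
splitCode′ [] (x ∷ y ∷ w) s u p ()
splitCode′ (d ∷ ds) [] .d u (pd ∷ p) refl = inj₂ (pd , lem ds)
  where lem : ∀ ds → ∃ λ s' → ∃ λ u' → ds ++ E ∷ [] ≡ s' ∷ u'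
        lem [] = E , [] , refl
        lem (x ∷ ds) = x , ds ++ E ∷ [] , refl
splitCode′ (d ∷ ds) (x ∷ w) s u (pd ∷ p) e with splitCode′ ds w s u p (LP.∷-injectiveʳ e)
... | inj₁ (a , b , c) = inj₁ (a , b , cong₂ _∷_ (sym (LP.∷-injectiveˡ e)) c)
... | inj₂ r = inj₂ r

splitCode : ∀ m w s u → encAtom m ≡ w ++ s ∷ u → CodeSplit m w s u
splitCode m w s u e with splitCode′ (digits m) w s u (encBin-digits (fromℕ m)) e
... | inj₁ (a , b , c) = atEnd a b c
... | inj₂ (a , b) = atDigit a b

encAtom-≢# : ∀ m → All ≢# (encAtom m)
encAtom-≢# m = AllP.++⁺ (lem (encBin-digits (fromℕ m))) (refl ∷ [])
  where lem : ∀ {xs} → All Digit xs → All ≢# xs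
        lem [] = []
        lem (digit1 ∷ p) = refl ∷ lem p
        lem (digit2 ∷ p) = refl ∷ lem p

encModel-≢# : ∀ xs → All ≢# (encModel xs)
encModel-≢# [] = []
encModel-≢# (x ∷ xs) = AllP.++⁺ (encAtom-≢# x) (encModel-≢# xs)

encModel-++ : ∀ xs ys → encModel (xs ++ ys) ≡ encModel xs ++ encModel ys
encModel-++ [] ys = refl
encModel-++ (x ∷ xs) ys rewrite encModel-++ xs ys = sym (LP.++-assoc (encAtom x) (encModel xs) (encModel ys))

-- The formula region

if-true : ∀ {X : Set} {b} (x y : X) → b ≡ true → (if b then x else y) ≡ x
if-true x y refl = refl
if-false : ∀ {X : Set} {b} (x y : X) → b ≡ false → (if b then x else y) ≡ y
if-false x y refl = refl

module Rendering (M : Model) where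
  open PrefixSemantics M public

  data Stage : Set where
    stable updated : Stage

  reached : Stage → ℕ → Fml → Bool
  reached stable i χ = leB (height χ) i
  reached updated i χ = leB (height χ) (suc i)

  boxFlag : Stage → ℕ → ℕ → Fml → Bool
  boxFlag ph i k (□ ψ) = if reached ph i (□ ψ) then holdsBelow ψ (suc k) else holdsBelow ψ k
  boxFlag ph i k (atom _) = true
  boxFlag ph i k (¬' _) = true
  boxFlag ph i k (_ ∧' _) = true

  nodeStatus : Stage → ℕ → ℕ → Fml → Bool → Status
  nodeStatus ph i k χ true = dead
  nodeStatus stable i k χ false = if leB (height χ) i then val (evalAt χ k) else op
  nodeStatus updated i k χ false = if leB (height χ) i then val (evalAt χ k) else (if leB (height χ) (suc i) then new (evalAt χ k) else op)

  belowValue : ℕ → Fml → Bool → Bool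
  belowValue i χ pe = pe ∨ leB (height χ) i

  nodeOf : Stage → ℕ → ℕ → Fml → Bool → Node
  nodeOf ph i k χ pe = node (boxFlag ph i k χ) (nodeStatus ph i k χ pe)

  headSym : Fml → Sym
  headSym (atom _) = A
  headSym (¬' _) = N
  headSym (_ ∧' _) = K
  headSym (□ _) = B

  headSym-≢# : ∀ χ → isHash (headSym χ) ≡ false
  headSym-≢# (atom _) = refl
  headSym-≢# (¬' _) = refl
  headSym-≢# (_ ∧' _) = refl
  headSym-≢# (□ _) = refl

  -- The formula region at prefix k in round i, in Polish notation, with ac a the cells of the
  -- code of atom a.  In the stable stage the nodes of height ≤ i are evaluated: the maximal
  -- ones hold their value, the ones below them (pe: an ancestor is evaluated) are dead.  The
  -- updated stage is what the left sweep of round i leaves: nodes of height i + 1 are new.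
  mutual
    render : Stage → ℕ → ℕ → (ℕ → List Cell) → Bool → Fml → List Cell
    render ph i k ac pe χ = cell (headSym χ) freshMarks (nodeOf ph i k χ pe) ∷ renderArgs ph i k ac (belowValue i χ pe) χ

    renderArgs : Stage → ℕ → ℕ → (ℕ → List Cell) → Bool → Fml → List Cell
    renderArgs ph i k ac pe (atom a) = ac a
    renderArgs ph i k ac pe (¬' ψ) = render ph i k ac pe ψ
    renderArgs ph i k ac pe (φ ∧' ψ) = render ph i k ac pe φ ++ render ph i k ac pe ψ
    renderArgs ph i k ac pe (□ ψ) = render ph i k ac pe ψ

  module KillSweep (i k : ℕ) (ac : ℕ → List Cell) (acK : ∀ a kk → sweepRight EV (rKill false kk) (ac a) ≡ (rKill false kk , ac a)) where

    KillsTo : Pending → List Cell → List Cell → Pending → Set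
    KillsTo kk xs ys kk' = sweepRight EV (rKill false kk) xs ≡ (rKill false kk' , ys)

    killPending : Pending → Bool
    killPending k0 = false
    killPending _ = true

    predPending : Pending → Pending
    predPending k0 = k0
    predPending k1 = k0
    predPending k2 = k1

    isNew : Status → Bool
    isNew (new _) = true
    isNew _ = false

    valOrDead : Pending → Bool → Status
    valOrDead k0 v = val v
    valOrDead _ v = dead

    kill-dead-cell : ∀ kk s f → isHash s ≡ false → stepR EV (rKill false kk) (cell s freshMarks (node f dead)) ≡ (rKill false kk , cell s freshMarks (node f dead))
    kill-dead-cell kk s f e rewrite e = refl

    kill-idle-cell : ∀ s f st → isHash s ≡ false → isNew st ≡ false → stepR EV (rKill false k0) (cell s freshMarks (node f st)) ≡ (rKill false k0 , cell s freshMarks (node f st))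
    kill-idle-cell s f dead e n rewrite e = refl
    kill-idle-cell s f op e n rewrite e = refl
    kill-idle-cell s f (val v) e n rewrite e = refl

    kill-valued-cell : ∀ kk s f v → isHash s ≡ false → stepR EV (rKill false kk) (cell s freshMarks (node f (val v))) ≡ (rKill false (predPending kk) , cell s freshMarks (node f (valOrDead kk v)))
    kill-valued-cell k0 s f v e rewrite e = refl
    kill-valued-cell k1 s f v e rewrite e = refl
    kill-valued-cell k2 s f v e rewrite e = refl

    kill-new-cell : ∀ s f v → isHash s ≡ false → stepR EV (rKill false k0) (cell s freshMarks (node f (new v))) ≡ (rKill false (arity s) , cell s freshMarks (node f (val v)))
    kill-new-cell s f v e rewrite e = refl

    boxFlag-updated-stable : ∀ χ → boxFlag updated i k χ ≡ boxFlag stable (suc i) k χ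
    boxFlag-updated-stable (atom _) = refl
    boxFlag-updated-stable (¬' _) = refl
    boxFlag-updated-stable (_ ∧' _) = refl
    boxFlag-updated-stable (□ _) = refl

    mutual
      kill-dead : ∀ χ kk → KillsTo kk (render updated i k ac true χ) (render stable (suc i) k ac true χ) kk
      kill-dead χ kk rewrite boxFlag-updated-stable χ =
        sweepRight-∷ EV (rKill false kk) (cell (headSym χ) freshMarks (node (boxFlag stable (suc i) k χ) dead)) (renderArgs updated i k ac true χ)
          (kill-dead-cell kk (headSym χ) _ (headSym-≢# χ)) (kill-dead-args χ kk)

      kill-dead-args : ∀ χ kk → KillsTo kk (renderArgs updated i k ac true χ) (renderArgs stable (suc i) k ac true χ) kk
      kill-dead-args (atom a) kk = acK a kk
      kill-dead-args (¬' ψ) kk = kill-dead ψ kk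
      kill-dead-args (φ ∧' ψ) kk = sweepRight-++ EV (rKill false kk) (render updated i k ac true φ) _ (kill-dead φ kk) (kill-dead ψ kk)
      kill-dead-args (□ ψ) kk = kill-dead ψ kk

    kill-valued-root : ∀ χ kk → leB (height χ) i ≡ true →
      KillsTo kk (cell (headSym χ) freshMarks (node (boxFlag stable (suc i) k χ) (val (evalAt χ k))) ∷ renderArgs updated i k ac true χ)
            (cell (headSym χ) freshMarks (node (boxFlag stable (suc i) k χ) (valOrDead kk (evalAt χ k))) ∷ renderArgs stable (suc i) k ac true χ) (predPending kk)
    kill-valued-root χ kk e = sweepRight-∷ EV (rKill false kk) (cell (headSym χ) freshMarks (node (boxFlag stable (suc i) k χ) (val (evalAt χ k)))) (renderArgs updated i k ac true χ) (kill-valued-cell kk (headSym χ) _ _ (headSym-≢# χ)) (kill-dead-args χ (predPending kk))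

    kill-valued : ∀ χ → leB (height χ) i ≡ true → ∀ kk → KillsTo kk (render updated i k ac false χ) (render stable (suc i) k ac (killPending kk) χ) (predPending kk)
    kill-valued χ e k0 rewrite e | leB-suc (height χ) i e | boxFlag-updated-stable χ = kill-valued-root χ k0 e
    kill-valued χ e k1 rewrite e | boxFlag-updated-stable χ = kill-valued-root χ k1 e
    kill-valued χ e k2 rewrite e | boxFlag-updated-stable χ = kill-valued-root χ k2 e

    kill-new-args : ∀ χ → leB (height χ) i ≡ false → leB (height χ) (suc i) ≡ true →
      KillsTo (arity (headSym χ)) (renderArgs updated i k ac false χ) (renderArgs stable (suc i) k ac true χ) k0
    kill-new-args (atom a) () e2
    kill-new-args (¬' ψ) e1 e2 = kill-valued ψ e2 k1
    kill-new-args (φ ∧' ψ) e1 e2 =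
      sweepRight-++ EV (rKill false k2) (render updated i k ac false φ) _ (kill-valued φ (proj₁ (leB-⊔ (height φ) (height ψ) i e2)) k2)
                (kill-valued ψ (proj₂ (leB-⊔ (height φ) (height ψ) i e2)) k1)
    kill-new-args (□ ψ) e1 e2 = kill-valued ψ e2 k1

    mutual
      kill-updated : ∀ χ → KillsTo k0 (render updated i k ac false χ) (render stable (suc i) k ac false χ) k0
      kill-updated χ = kill-updated-by-height χ (leB (height χ) i) refl (leB (height χ) (suc i)) refl

      kill-updated-by-height : ∀ χ b1 → leB (height χ) i ≡ b1 → ∀ b2 → leB (height χ) (suc i) ≡ b2 →
           KillsTo k0 (render updated i k ac false χ) (render stable (suc i) k ac false χ) k0
      kill-updated-by-height χ true e1 b2 e2 = kill-valued χ e1 k0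
      kill-updated-by-height χ false e1 true e2 rewrite e1 | e2 | boxFlag-updated-stable χ =
        sweepRight-∷ EV (rKill false k0) (cell (headSym χ) freshMarks (node (boxFlag stable (suc i) k χ) (new (evalAt χ k)))) (renderArgs updated i k ac false χ) (kill-new-cell (headSym χ) _ _ (headSym-≢# χ)) (kill-new-args χ e1 e2)
      kill-updated-by-height χ false e1 false e2 rewrite e1 | e2 | boxFlag-updated-stable χ =
        sweepRight-∷ EV (rKill false k0) (cell (headSym χ) freshMarks (node (boxFlag stable (suc i) k χ) op)) (renderArgs updated i k ac false χ) (kill-idle-cell (headSym χ) _ op (headSym-≢# χ) refl) (kill-updated-args χ)

      kill-updated-args : ∀ χ → KillsTo k0 (renderArgs updated i k ac false χ) (renderArgs stable (suc i) k ac false χ) k0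
      kill-updated-args (atom a) = acK a k0
      kill-updated-args (¬' ψ) = kill-updated ψ
      kill-updated-args (φ ∧' ψ) = sweepRight-++ EV (rKill false k0) (render updated i k ac false φ) _ (kill-updated φ) (kill-updated ψ)
      kill-updated-args (□ ψ) = kill-updated ψ

    nodeStatus-stable-¬new : ∀ χ pe → isNew (nodeStatus stable i k χ pe) ≡ false
    nodeStatus-stable-¬new χ true = refl
    nodeStatus-stable-¬new χ false with leB (height χ) i
    ... | true = refl
    ... | false = refl

    mutual
      kill-stable : ∀ χ pe → KillsTo k0 (render stable i k ac pe χ) (render stable i k ac pe χ) k0
      kill-stable χ pe = sweepRight-∷ EV (rKill false k0) (cell (headSym χ) freshMarks (nodeOf stable i k χ pe)) (renderArgs stable i k ac (belowValue i χ pe) χ)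
        (kill-idle-cell (headSym χ) (boxFlag stable i k χ) (nodeStatus stable i k χ pe) (headSym-≢# χ) (nodeStatus-stable-¬new χ pe)) (kill-stable-args χ (belowValue i χ pe))

      kill-stable-args : ∀ χ pe → KillsTo k0 (renderArgs stable i k ac pe χ) (renderArgs stable i k ac pe χ) k0
      kill-stable-args (atom a) pe = acK a k0
      kill-stable-args (¬' ψ) pe = kill-stable ψ pe
      kill-stable-args (φ ∧' ψ) pe = sweepRight-++ EV (rKill false k0) (render stable i k ac pe φ) _ (kill-stable φ pe) (kill-stable ψ pe)
      kill-stable-args (□ ψ) pe = kill-stable ψ pe

  module ReduceSweep (i k : ℕ) (ac : ℕ → List Cell)
             (acR : ∀ a u1 u2 lv → sweepLeft (lEV false u1 u2 lv) (ac a) ≡ (lEV false u1 u2 nothing , ac a)) where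

    ReducesTo : Maybe Bool → Maybe Bool → Maybe Bool → List Cell → LeftState → List Cell → Set
    ReducesTo u1 u2 lv xs l ys = sweepLeft (lEV false u1 u2 lv) xs ≡ (l , ys)

    boxFlag-stable-updated : ∀ χ → leB (height χ) i ≡ true → boxFlag stable i k χ ≡ boxFlag updated i k χ
    boxFlag-stable-updated (atom _) e = refl
    boxFlag-stable-updated (¬' _) e = refl
    boxFlag-stable-updated (_ ∧' _) e = refl
    boxFlag-stable-updated (□ ψ) e rewrite e | leB-suc (height (□ ψ)) i e = refl

    mutual
      reduce-dead : ∀ χ → leB (height χ) i ≡ true → ∀ u1 u2 lv →
        ReducesTo u1 u2 lv (render stable i k ac true χ) (lEV false u1 u2 nothing) (render updated i k ac true χ)
      reduce-dead χ e u1 u2 lv rewrite boxFlag-stable-updated χ e =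
        sweepLeft-∷ (lEV false u1 u2 lv) _ (renderArgs stable i k ac true χ) (reduce-dead-args χ e u1 u2 lv) refl

      reduce-dead-args : ∀ χ → leB (height χ) i ≡ true → ∀ u1 u2 lv →
        ReducesTo u1 u2 lv (renderArgs stable i k ac true χ) (lEV false u1 u2 nothing) (renderArgs updated i k ac true χ)
      reduce-dead-args (atom a) e u1 u2 lv = acR a u1 u2 lv
      reduce-dead-args (¬' ψ) e u1 u2 lv = reduce-dead ψ (leB-sucˡ (height ψ) i e) u1 u2 lv
      reduce-dead-args (φ ∧' ψ) e u1 u2 lv =
        sweepLeft-++ (lEV false u1 u2 lv) (render stable i k ac true φ) (render stable i k ac true ψ)
          (reduce-dead ψ (proj₂ (leB-⊔ (height φ) (height ψ) i (leB-sucˡ _ i e))) u1 u2 lv)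
          (reduce-dead φ (proj₁ (leB-⊔ (height φ) (height ψ) i (leB-sucˡ _ i e))) u1 u2 nothing)
      reduce-dead-args (□ ψ) e u1 u2 lv = reduce-dead ψ (leB-sucˡ (height ψ) i e) u1 u2 lv

    reduce-valued : ∀ χ → leB (height χ) i ≡ true → ∀ u1 u2 lv →
      ReducesTo u1 u2 lv (render stable i k ac false χ) (lEV false (just (evalAt χ k)) u1 (just (evalAt χ k))) (render updated i k ac false χ)
    reduce-valued χ e u1 u2 lv rewrite e | boxFlag-stable-updated χ e =
      sweepLeft-∷ (lEV false u1 u2 lv) _ (renderArgs stable i k ac true χ) (reduce-dead-args χ e u1 u2 lv) refl

    ReducesTo-cong : ∀ {u1 u2 lv xs xs' l ys ys'} → xs ≡ xs' → ys ≡ ys' → ReducesTo u1 u2 lv xs' l ys' → ReducesTo u1 u2 lv xs l ys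
    ReducesTo-cong refl refl p = p

    render-stable-¬ : ∀ ψ → leB (height (¬' ψ)) i ≡ false → render stable i k ac false (¬' ψ) ≡ cell N freshMarks (node true op) ∷ render stable i k ac false ψ
    render-stable-¬ ψ e rewrite e = refl
    render-stable-□ : ∀ ψ → leB (height (□ ψ)) i ≡ false → render stable i k ac false (□ ψ) ≡ cell B freshMarks (node (holdsBelow ψ k) op) ∷ render stable i k ac false ψ
    render-stable-□ ψ e rewrite e = refl
    render-stable-∧ : ∀ φ ψ → leB (height (φ ∧' ψ)) i ≡ false → render stable i k ac false (φ ∧' ψ) ≡ cell K freshMarks (node true op) ∷ (render stable i k ac false φ ++ render stable i k ac false ψ)
    render-stable-∧ φ ψ e rewrite e = refl

    render-updated-¬ : ∀ ψ → leB (height (¬' ψ)) i ≡ false → render updated i k ac false (¬' ψ) ≡ cell N freshMarks (node true (if leB (height ψ) i then new (not (evalAt ψ k)) else op)) ∷ render updated i k ac false ψ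
    render-updated-¬ ψ e rewrite e = refl
    render-updated-□ : ∀ ψ → leB (height (□ ψ)) i ≡ false → render updated i k ac false (□ ψ) ≡
       cell B freshMarks (node (if leB (height ψ) i then holdsBelow ψ (suc k) else holdsBelow ψ k) (if leB (height ψ) i then new (holdsBelow ψ (suc k)) else op)) ∷ render updated i k ac false ψ
    render-updated-□ ψ e rewrite e = refl
    render-updated-∧ : ∀ φ ψ → leB (height (φ ∧' ψ)) i ≡ false → render updated i k ac false (φ ∧' ψ) ≡
       cell K freshMarks (node true (if leB (height φ ⊔ height ψ) i then new (evalAt φ k ∧ evalAt ψ k) else op)) ∷ (render updated i k ac false φ ++ render updated i k ac false ψ)
    render-updated-∧ φ ψ e rewrite e = refl

    reduce-new : ∀ χ → leB (height χ) i ≡ false → leB (height χ) (suc i) ≡ true → ∀ u1 u2 lv →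
      Σ (Maybe Bool) λ j → ReducesTo u1 u2 lv (render stable i k ac false χ) (lEV false nothing j (just (evalAt χ k))) (render updated i k ac false χ)
    reduce-new (atom a) () e2 u1 u2 lv
    reduce-new (¬' ψ) e1 e2 u1 u2 lv = just (evalAt ψ k) ,
      ReducesTo-cong (render-stable-¬ ψ e1) (trans (render-updated-¬ ψ e1) (cong (λ z → cell N freshMarks (node true z) ∷ render updated i k ac false ψ) (if-true _ _ e2)))
        (sweepLeft-∷ (lEV false u1 u2 lv) (cell N freshMarks (node true op)) (render stable i k ac false ψ) (reduce-valued ψ e2 u1 u2 lv) refl)
    reduce-new (□ ψ) e1 e2 u1 u2 lv = just (evalAt ψ k) ,
      ReducesTo-cong (render-stable-□ ψ e1) (trans (render-updated-□ ψ e1) (cong₂ (λ z z' → cell B freshMarks (node z z') ∷ render updated i k ac false ψ) (if-true _ _ e2) (if-true _ _ e2)))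
        (sweepLeft-∷ (lEV false u1 u2 lv) (cell B freshMarks (node (holdsBelow ψ k) op)) (render stable i k ac false ψ) (reduce-valued ψ e2 u1 u2 lv) refl)
    reduce-new (φ ∧' ψ) e1 e2 u1 u2 lv = just (evalAt φ k) ,
      ReducesTo-cong (render-stable-∧ φ ψ e1) (trans (render-updated-∧ φ ψ e1) (cong (λ z → cell K freshMarks (node true z) ∷ (render updated i k ac false φ ++ render updated i k ac false ψ)) (if-true _ _ e2)))
        (sweepLeft-∷ (lEV false u1 u2 lv) (cell K freshMarks (node true op)) (render stable i k ac false φ ++ render stable i k ac false ψ)
          (sweepLeft-++ (lEV false u1 u2 lv) (render stable i k ac false φ) (render stable i k ac false ψ)
            (reduce-valued ψ (proj₂ (leB-⊔ (height φ) (height ψ) i e2)) u1 u2 lv)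
            (reduce-valued φ (proj₁ (leB-⊔ (height φ) (height ψ) i e2)) (just (evalAt ψ k)) u1 (just (evalAt ψ k)))) refl)

    mutual
      reduce-above : ∀ χ → leB (height χ) (suc i) ≡ false → ∀ u1 u2 lv →
        Σ (Maybe Bool) λ j → ReducesTo u1 u2 lv (render stable i k ac false χ) (lEV false nothing j nothing) (render updated i k ac false χ)
      reduce-above (atom a) () u1 u2 lv
      reduce-above (¬' ψ) e u1 u2 lv with reduce-unvalued ψ e u1 u2 lv
      ... | (j , lv' , p) = nothing ,
        ReducesTo-cong (render-stable-¬ ψ (leB-false-pred (suc (height ψ)) i e)) (trans (render-updated-¬ ψ (leB-false-pred (suc (height ψ)) i e)) (cong (λ z → cell N freshMarks (node true z) ∷ render updated i k ac false ψ) (if-false _ _ e)))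
          (sweepLeft-∷ (lEV false u1 u2 lv) (cell N freshMarks (node true op)) (render stable i k ac false ψ) p refl)
      reduce-above (□ ψ) e u1 u2 lv with reduce-unvalued ψ e u1 u2 lv
      ... | (j , lv' , p) = nothing ,
        ReducesTo-cong (render-stable-□ ψ (leB-false-pred (suc (height ψ)) i e)) (trans (render-updated-□ ψ (leB-false-pred (suc (height ψ)) i e)) (cong₂ (λ z z' → cell B freshMarks (node z z') ∷ render updated i k ac false ψ) (if-false _ _ e) (if-false _ _ e)))
          (sweepLeft-∷ (lEV false u1 u2 lv) (cell B freshMarks (node (holdsBelow ψ k) op)) (render stable i k ac false ψ) p refl)
      reduce-above (φ ∧' ψ) e u1 u2 lv = rcK (leB (height φ) i) refl
        where
        rcK : ∀ b → leB (height φ) i ≡ b → Σ (Maybe Bool) λ j → ReducesTo u1 u2 lv (render stable i k ac false (φ ∧' ψ)) (lEV false nothing j nothing) (render updated i k ac false (φ ∧' ψ))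
        rcK false eφ with reduce-any ψ u1 u2 lv
        ... | (s1 , s2 , s3 , p) with reduce-unvalued φ eφ s1 s2 s3
        ... | (j , lv' , q) = nothing ,
          ReducesTo-cong (render-stable-∧ φ ψ (leB-false-pred (suc (height φ ⊔ height ψ)) i e)) (trans (render-updated-∧ φ ψ (leB-false-pred (suc (height φ ⊔ height ψ)) i e)) (cong (λ z → cell K freshMarks (node true z) ∷ (render updated i k ac false φ ++ render updated i k ac false ψ)) (if-false _ _ e)))
            (sweepLeft-∷ (lEV false u1 u2 lv) (cell K freshMarks (node true op)) (render stable i k ac false φ ++ render stable i k ac false ψ)
              (sweepLeft-++ (lEV false u1 u2 lv) (render stable i k ac false φ) (render stable i k ac false ψ) p q) refl)
        rcK true eφ with reduce-unvalued ψ (leB-⊔f (height φ) (height ψ) i e eφ) u1 u2 lv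
        ... | (j , lv' , p) = just (evalAt φ k) ,
          ReducesTo-cong (render-stable-∧ φ ψ (leB-false-pred (suc (height φ ⊔ height ψ)) i e)) (trans (render-updated-∧ φ ψ (leB-false-pred (suc (height φ ⊔ height ψ)) i e)) (cong (λ z → cell K freshMarks (node true z) ∷ (render updated i k ac false φ ++ render updated i k ac false ψ)) (if-false _ _ e)))
            (sweepLeft-∷ (lEV false u1 u2 lv) (cell K freshMarks (node true op)) (render stable i k ac false φ ++ render stable i k ac false ψ)
              (sweepLeft-++ (lEV false u1 u2 lv) (render stable i k ac false φ) (render stable i k ac false ψ) p (reduce-valued φ eφ nothing j lv')) refl)

      reduce-unvalued : ∀ χ → leB (height χ) i ≡ false → ∀ u1 u2 lv →
        Σ (Maybe Bool) λ j → Σ (Maybe Bool) λ lv' → ReducesTo u1 u2 lv (render stable i k ac false χ) (lEV false nothing j lv') (render updated i k ac false χ)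
      reduce-unvalued χ e u1 u2 lv = reduce-unvalued-by-height χ e (leB (height χ) (suc i)) refl u1 u2 lv

      reduce-unvalued-by-height : ∀ χ → leB (height χ) i ≡ false → ∀ b → leB (height χ) (suc i) ≡ b → ∀ u1 u2 lv →
        Σ (Maybe Bool) λ j → Σ (Maybe Bool) λ lv' → ReducesTo u1 u2 lv (render stable i k ac false χ) (lEV false nothing j lv') (render updated i k ac false χ)
      reduce-unvalued-by-height χ e true e2 u1 u2 lv with reduce-new χ e e2 u1 u2 lv
      ... | (j , p) = j , just (evalAt χ k) , p
      reduce-unvalued-by-height χ e false e2 u1 u2 lv with reduce-above χ e2 u1 u2 lv
      ... | (j , p) = j , nothing , p

      reduce-any : ∀ χ u1 u2 lv → Σ (Maybe Bool) λ s1 → Σ (Maybe Bool) λ s2 → Σ (Maybe Bool) λ s3 →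
        ReducesTo u1 u2 lv (render stable i k ac false χ) (lEV false s1 s2 s3) (render updated i k ac false χ)
      reduce-any χ u1 u2 lv = reduce-any-by-height χ (leB (height χ) i) refl u1 u2 lv

      reduce-any-by-height : ∀ χ b → leB (height χ) i ≡ b → ∀ u1 u2 lv → Σ (Maybe Bool) λ s1 → Σ (Maybe Bool) λ s2 → Σ (Maybe Bool) λ s3 →
        ReducesTo u1 u2 lv (render stable i k ac false χ) (lEV false s1 s2 s3) (render updated i k ac false χ)
      reduce-any-by-height χ true e u1 u2 lv = _ , _ , _ , reduce-valued χ e u1 u2 lv
      reduce-any-by-height χ false e u1 u2 lv with reduce-unvalued χ e u1 u2 lv
      ... | (j , lv' , p) = _ , _ , _ , p

module Passes (M : Model) where
  open Rendering M public

  module FetchSweep (r : Bool) (f : Maybe Sym) (ph : Stage) (i k : ℕ) (ac : ℕ → List Cell)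
     (fetch-atomCells : ∀ a → sweepRight (CP nothing r) (rFetch false f) (ac a) ≡ (rFetch false f , ac a)) where
    fetch-formula-cell : ∀ s W → isHash s ≡ false → stepR (CP nothing r) (rFetch false f) (cell s freshMarks W) ≡ (rFetch false f , cell s freshMarks W)
    fetch-formula-cell s W e rewrite e = refl

    mutual
      fetch-render : ∀ χ pe → sweepRight (CP nothing r) (rFetch false f) (render ph i k ac pe χ) ≡ (rFetch false f , render ph i k ac pe χ)
      fetch-render χ pe = sweepRight-∷ (CP nothing r) (rFetch false f) _ (renderArgs ph i k ac (belowValue i χ pe) χ) (fetch-formula-cell (headSym χ) _ (headSym-≢# χ)) (fetch-renderArgs χ (belowValue i χ pe))

      fetch-renderArgs : ∀ χ pe → sweepRight (CP nothing r) (rFetch false f) (renderArgs ph i k ac pe χ) ≡ (rFetch false f , renderArgs ph i k ac pe χ)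
      fetch-renderArgs (atom a) pe = fetch-atomCells a
      fetch-renderArgs (¬' ψ) pe = fetch-render ψ pe
      fetch-renderArgs (φ ∧' ψ) pe = sweepRight-++ (CP nothing r) (rFetch false f) (render ph i k ac pe φ) _ (fetch-render φ pe) (fetch-render ψ pe)
      fetch-renderArgs (□ ψ) pe = fetch-render ψ pe

  module CompareSweep (s : Sym) (r : Bool) (ph : Stage) (i k : ℕ) (ac ac' : ℕ → List Cell) (g : ℕ → Match)
     (acC : ∀ a → sweepRight (CP (just s) r) (rCmp search) (ac a) ≡ (rCmp (g a) , ac' a)) where
    mutual
      compare-render : ∀ χ pe a0 → Σ Match λ a' → sweepRight (CP (just s) r) (rCmp a0) (render ph i k ac pe χ) ≡ (rCmp a' , render ph i k ac' pe χ)
      compare-render (atom a) pe a0 = g a , sweepRight-∷ (CP (just s) r) (rCmp a0) (cell A freshMarks (nodeOf ph i k (atom a) pe)) (ac a) refl (acC a)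
      compare-render (¬' ψ) pe a0 with compare-render ψ (belowValue i (¬' ψ) pe) a0
      ... | (a' , p) = a' , sweepRight-∷ (CP (just s) r) (rCmp a0) (cell N freshMarks (nodeOf ph i k (¬' ψ) pe)) (render ph i k ac _ ψ) refl p
      compare-render (□ ψ) pe a0 with compare-render ψ (belowValue i (□ ψ) pe) a0
      ... | (a' , p) = a' , sweepRight-∷ (CP (just s) r) (rCmp a0) (cell B freshMarks (nodeOf ph i k (□ ψ) pe)) (render ph i k ac _ ψ) refl p
      compare-render (φ ∧' ψ) pe a0 with compare-render φ (belowValue i (φ ∧' ψ) pe) a0
      ... | (a1 , p1) with compare-render ψ (belowValue i (φ ∧' ψ) pe) a1
      ... | (a2 , p2) = a2 , sweepRight-∷ (CP (just s) r) (rCmp a0) (cell K freshMarks (nodeOf ph i k (φ ∧' ψ) pe)) (render ph i k ac _ φ ++ render ph i k ac _ ψ) refl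
                               (sweepRight-++ (CP (just s) r) (rCmp a0) (render ph i k ac _ φ) _ p1 p2)

  module ReinitSweep (i k : ℕ) (ac : ℕ → List Cell)
     (acI : ∀ a sn0 → sweepLeft (lInit false sn0) (ac a) ≡ (lInit false (elemᵇ a (take (suc k) M)) , ac a)) where
    boxFlag-updated-□ : ∀ ψ → leB (height ψ) i ≡ true → boxFlag updated i k (□ ψ) ≡ holdsBelow ψ (suc k)
    boxFlag-updated-□ ψ e rewrite e = refl

    mutual
      reinit-render : ∀ χ pe → leB (height χ) (suc i) ≡ true → ∀ sn0 →
        Σ Bool λ sn → sweepLeft (lInit false sn0) (render updated i k ac pe χ) ≡ (lInit false sn , render stable 0 (suc k) ac false χ)
      reinit-render (atom a) pe e sn0 = _ , sweepLeft-∷ (lInit false sn0) (cell A freshMarks (nodeOf updated i k (atom a) pe)) (ac a) (acI a sn0) refl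
      reinit-render (¬' ψ) pe e sn0 with reinit-render ψ (belowValue i (¬' ψ) pe) (leB-suc (height ψ) i e) sn0
      ... | (sn , p) = _ , sweepLeft-∷ (lInit false sn0) (cell N freshMarks (nodeOf updated i k (¬' ψ) pe)) (render updated i k ac _ ψ) p refl
      reinit-render (□ ψ) pe e sn0 with reinit-render ψ (belowValue i (□ ψ) pe) (leB-suc (height ψ) i e) sn0
      ... | (sn , p) = _ , sweepLeft-∷ (lInit false sn0) (cell B freshMarks (node (boxFlag updated i k (□ ψ)) (nodeStatus updated i k (□ ψ) pe))) (render updated i k ac _ ψ) p
                             (cong (λ z → lInit false sn , cell B freshMarks (node z op)) (boxFlag-updated-□ ψ e))
      reinit-render (φ ∧' ψ) pe e sn0 with reinit-render ψ (belowValue i (φ ∧' ψ) pe) (leB-suc (height ψ) i (proj₂ (leB-⊔ (height φ) (height ψ) i e))) sn0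
      ... | (sn1 , p1) with reinit-render φ (belowValue i (φ ∧' ψ) pe) (leB-suc (height φ) i (proj₁ (leB-⊔ (height φ) (height ψ) i e))) sn1
      ... | (sn2 , p2) = _ , sweepLeft-∷ (lInit false sn0) (cell K freshMarks (nodeOf updated i k (φ ∧' ψ) pe)) (render updated i k ac _ φ ++ render updated i k ac _ ψ)
                               (sweepLeft-++ (lInit false sn0) (render updated i k ac _ φ) _ p1 p2) refl

-- The model region

hashCell : Cell
hashCell = cell # freshMarks (node true dead)

modelCell : Bool → Sym → Cell
modelCell b s = cell s (marks b true false) (node true dead)

modelCells : List Sym → List Sym → List Cell
modelCells U V = map (modelCell true) U ++ map (modelCell false) V

sweepLeft-modelCells-id : ∀ l → (∀ b s → ≢# s → stepL l (modelCell b s) ≡ (l , modelCell b s)) → ∀ b xs → All ≢# xs → sweepLeft l (map (modelCell b) xs) ≡ (l , map (modelCell b) xs)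
sweepLeft-modelCells-id l h b [] [] = refl
sweepLeft-modelCells-id l h b (x ∷ xs) (p ∷ ps) = sweepLeft-∷ l (modelCell b x) (map (modelCell b) xs) (sweepLeft-modelCells-id l h b xs ps) (h b x p)

sweepLeft-modelCells : ∀ l → (∀ b s → ≢# s → stepL l (modelCell b s) ≡ (l , modelCell b s)) → ∀ U V → All ≢# U → All ≢# V → sweepLeft l (modelCells U V) ≡ (l , modelCells U V)
sweepLeft-modelCells l h U V pU pV = sweepLeft-++ l (map (modelCell true) U) (map (modelCell false) V) (sweepLeft-modelCells-id l h false V pV) (sweepLeft-modelCells-id l h true U pU)

skip-evaluation : ∀ u1 u2 lv b s → ≢# s → stepL (lEV true u1 u2 lv) (modelCell b s) ≡ (lEV true u1 u2 lv , modelCell b s)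
skip-evaluation u1 u2 lv b s e rewrite e = refl

skip-reinit : ∀ sn b s → ≢# s → stepL (lInit true sn) (modelCell b s) ≡ (lInit true sn , modelCell b s)
skip-reinit sn b s e rewrite e = refl

sweepRight-kill-done : ∀ kk xs → sweepRight EV (rKill true kk) xs ≡ (rKill true kk , xs)
sweepRight-kill-done kk [] = refl
sweepRight-kill-done kk (x ∷ xs) = sweepRight-∷ EV (rKill true kk) x xs refl (sweepRight-kill-done kk xs)

sweepRight-fetch-done : ∀ r f xs → sweepRight (CP (just E) r) (rFetch true f) xs ≡ (rFetch true f , xs)
sweepRight-fetch-done r f [] = refl
sweepRight-fetch-done r f (x ∷ xs) = sweepRight-∷ (CP (just E) r) (rFetch true f) x xs refl (sweepRight-fetch-done r f xs)

module FetchModel (c : Phase) (hc : ∀ f x → stepR c (rFetch true f) x ≡ fetchStep true f x) where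
  fetch-crossed : ∀ f U → sweepRight c (rFetch true f) (map (modelCell true) U) ≡ (rFetch true f , map (modelCell true) U)
  fetch-crossed f [] = refl
  fetch-crossed f (x ∷ U) = sweepRight-∷ c (rFetch true f) (modelCell true x) (map (modelCell true) U) (trans (hc f (modelCell true x)) (h f)) (fetch-crossed f U)
    where h : ∀ f → fetchStep true f (modelCell true x) ≡ (rFetch true f , modelCell true x)
          h nothing = refl
          h (just _) = refl

  fetch-uncrossed : ∀ s V → sweepRight c (rFetch true (just s)) (map (modelCell false) V) ≡ (rFetch true (just s) , map (modelCell false) V)
  fetch-uncrossed s [] = refl
  fetch-uncrossed s (x ∷ V) = sweepRight-∷ c (rFetch true (just s)) (modelCell false x) (map (modelCell false) V) (hc (just s) (modelCell false x)) (fetch-uncrossed s V)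

  fetch-some : ∀ U s V → sweepRight c (rFetch true nothing) (modelCells U (s ∷ V)) ≡ (rFetch true (just s) , modelCells (U ∷ʳ s) V)
  fetch-some U s V rewrite LP.map-++ (modelCell true) U (s ∷ []) | LP.++-assoc (map (modelCell true) U) (modelCell true s ∷ []) (map (modelCell false) V) =
    sweepRight-++ c (rFetch true nothing) (map (modelCell true) U) (modelCell false s ∷ map (modelCell false) V) (fetch-crossed nothing U)
      (sweepRight-∷ c (rFetch true nothing) (modelCell false s) (map (modelCell false) V) (hc nothing (modelCell false s)) (fetch-uncrossed s V))

  fetch-none : ∀ U → sweepRight c (rFetch true nothing) (modelCells U []) ≡ (rFetch true nothing , modelCells U [])
  fetch-none U = sweepRight-++ c (rFetch true nothing) (map (modelCell true) U) [] (fetch-crossed nothing U) refl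

-- Correctness and running time

take-drop-suc : ∀ {X : Set} k (xs : List X) m rest → drop k xs ≡ m ∷ rest → (take (suc k) xs ≡ take k xs ++ m ∷ []) × (drop (suc k) xs ≡ rest)
take-drop-suc zero (x ∷ xs) m rest refl = refl , refl
take-drop-suc (suc k) [] m rest ()
take-drop-suc (suc k) (x ∷ xs) m rest e with take-drop-suc k xs m rest e
... | (a , b) = cong (x ∷_) a , b

take-drop-nil : ∀ {X : Set} k (xs : List X) → drop k xs ≡ [] → take k xs ≡ xs
take-drop-nil zero [] e = refl
take-drop-nil (suc k) [] e = refl
take-drop-nil (suc k) (x ∷ xs) e = cong (x ∷_) (take-drop-nil k xs e)

encAtom-∷ : ∀ m → Σ Sym λ s1 → Σ (List Sym) λ u1 → encAtom m ≡ s1 ∷ u1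
encAtom-∷ m with encBin (fromℕ m)
... | [] = E , [] , refl
... | x ∷ xs = x , xs ++ E ∷ [] , refl

+-interchange : ∀ a b c d → (a + b) + (c + d) ≡ (a + c) + (b + d)
+-interchange = solve 4 (λ a b c d → (a :+ b) :+ (c :+ d) := (a :+ c) :+ (b :+ d)) refl
  where open +-*-Solver

length≡0 : ∀ {X : Set} (xs : List X) → length xs ≡ 0 → xs ≡ []
length≡0 [] e = refl

length≡suc : ∀ {X : Set} (xs : List X) d → length xs ≡ suc d → Σ X λ m → Σ (List X) λ rest → (xs ≡ m ∷ rest) × (length rest ≡ d)
length≡suc (x ∷ xs) d e = x , xs , refl , NP.suc-injective e

height<length : ∀ χ → suc (height χ) ≤ length (encFml χ)
height<length (atom a) = s≤s z≤n
height<length (¬' ψ) = s≤s (height<length ψ)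
height<length (□ ψ) = s≤s (height<length ψ)
height<length (φ ∧' ψ) = s≤s (subst (λ z → suc (height φ ⊔ height ψ) ≤ z) (sym (LP.length-++ (encFml φ)))
  (NP.⊔-lub (NP.≤-trans (height<length φ) (NP.m≤m+n _ _)) (NP.≤-trans (height<length ψ) (NP.m≤n+m _ _))))

encAtom-nonempty : ∀ m → 1 ≤ length (encAtom m)
encAtom-nonempty m = subst (1 ≤_) (sym (LP.length-++ (encBin (fromℕ m)))) (NP.m≤n+m 1 _)

length≤encModel : ∀ M → length M ≤ length (encModel M)
length≤encModel [] = z≤n
length≤encModel (m ∷ M) = subst (suc (length M) ≤_) (sym (LP.length-++ (encAtom m)))
  (NP.+-mono-≤ (encAtom-nonempty m) (length≤encModel M))

initial-digits : ∀ b → map initialCell (encBin b) ≡ digitCells (encBin b) []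
initial-digits zeroᵇ = refl
initial-digits 2[1+ b ] = cong (digitCell d2 false ∷_) (initial-digits b)
initial-digits 1+[2 b ] = cong (digitCell d1 false ∷_) (initial-digits b)

initial-atom-modelCells : ∀ m → map initialCell (encAtom m) ≡ map (modelCell false) (encAtom m)
initial-atom-modelCells m = trans (LP.map-++ initialCell (encBin (fromℕ m)) (E ∷ [])) (trans (cong (_++ initialCell E ∷ []) (h (fromℕ m))) (sym (LP.map-++ (modelCell false) (encBin (fromℕ m)) (E ∷ []))))
  where h : ∀ b → map initialCell (encBin b) ≡ map (modelCell false) (encBin b)
        h zeroᵇ = refl
        h 2[1+ b ] = cong (modelCell false d2 ∷_) (h b)
        h 1+[2 b ] = cong (modelCell false d1 ∷_) (h b)

initial-modelCells : ∀ M → map initialCell (encModel M) ≡ map (modelCell false) (encModel M)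
initial-modelCells [] = refl
initial-modelCells (m ∷ M) = trans (LP.map-++ initialCell (encAtom m) (encModel M))
  (trans (cong₂ _++_ (initial-atom-modelCells m) (initial-modelCells M)) (sym (LP.map-++ (modelCell false) (encAtom m) (encModel M))))

roundTime≤ : ∀ {m L} → L ≡ suc m → roundTime m ≤ suc L + suc L
roundTime≤ {m} refl = NP.+-monoˡ-≤ (suc (suc m)) (NP.n≤1+n (suc m))

cube-bound : ∀ {n m a} → n ≤ a * a + a * a → m ≤ a + a → n * m ≤ 4 * a ^ 3
cube-bound {a = a} n≤ m≤ = NP.≤-trans (NP.*-mono-≤ n≤ m≤) (NP.≤-reflexive (identity a))
  where
  open +-*-Solver
  identity : ∀ a → (a * a + a * a) * (a + a) ≡ 4 * a ^ 3
  identity = solve 1 (λ a → (a :* a :+ a :* a) :* (a :+ a) := con 4 :* (a :* (a :* (a :* con 1)))) refl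

module Correctness (φ : Fml) (M : Model) where
  open Passes M public

  h : ℕ
  h = height φ

  -- the code of atom a at prefix k, once the digits w of the next model atom are compared
  atomCells : ℕ → List Sym → ℕ → List Cell
  atomCells k w a = codeCells (digits a) w (startsWith (encAtom a) w) (elemᵇ a (take k M))

  tape : Stage → ℕ → ℕ → (ℕ → List Cell) → List Sym → List Sym → List Cell
  tape ph i k ac U V = render ph i k ac false φ ++ hashCell ∷ modelCells U V

  phaseAfter : ℕ → ℕ → Phase
  phaseAfter i k = if leB h (suc i) then CP nothing (evalAt φ k) else EV

  module Evaluation (k : ℕ) (w : List Sym) (U V : List Sym) (pU : All ≢# U) (pV : All ≢# V) where
    ac = atomCells k w

    kill-atomCells : ∀ a kk → sweepRight EV (rKill false kk) (ac a) ≡ (rKill false kk , ac a)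
    kill-atomCells a kk = kill-codeCells (fromℕ a) w _ _ kk

    reduce-atomCells : ∀ a u1 u2 lv → sweepLeft (lEV false u1 u2 lv) (ac a) ≡ (lEV false u1 u2 nothing , ac a)
    reduce-atomCells a u1 u2 lv = reduce-codeCells (fromℕ a) w _ _ u1 u2 lv

    phaseAfter-reached : ∀ i → leB h (suc i) ≡ true → phaseAfter i k ≡ CP nothing (evalAt φ k)
    phaseAfter-reached i reached = cong (λ b → if b then CP nothing (evalAt φ k) else EV) reached

    phaseAfter-unreached : ∀ i → leB h (suc i) ≡ false → phaseAfter i k ≡ EV
    phaseAfter-unreached i unreached = cong (λ b → if b then CP nothing (evalAt φ k) else EV) unreached

    reduce-formula : ∀ i → Σ LeftState λ l' → (sweepLeft (lEV false nothing nothing nothing) (render stable i k ac false φ) ≡ (l' , render updated i k ac false φ)) × (afterLeft l' ≡ phaseAfter i k)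
    reduce-formula i = by-height (leB h i) refl (leB h (suc i)) refl
      where
      open ReduceSweep i k ac reduce-atomCells
      by-height : ∀ b → leB h i ≡ b → ∀ b2 → leB h (suc i) ≡ b2 →
          Σ LeftState λ l' → (sweepLeft (lEV false nothing nothing nothing) (render stable i k ac false φ) ≡ (l' , render updated i k ac false φ)) × (afterLeft l' ≡ phaseAfter i k)
      by-height true e b2 e2 = _ , reduce-valued φ e nothing nothing nothing , sym (phaseAfter-reached i (leB-suc h i e))
      by-height false e true e2 with reduce-new φ e e2 nothing nothing nothing
      ... | (j , p) = _ , p , sym (phaseAfter-reached i e2)
      by-height false e false e2 with reduce-above φ e2 nothing nothing nothing
      ... | (j , p) = _ , p , sym (phaseAfter-unreached i e2)

    sweepLeft-evaluation : ∀ i → Σ LeftState λ l' → (sweepLeft (lEV true nothing nothing nothing) (tape stable i k ac U V) ≡ (l' , tape updated i k ac U V)) × (afterLeft l' ≡ phaseAfter i k)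
    sweepLeft-evaluation i with reduce-formula i
    ... | (l' , p , e) = l' , sweepLeft-++ (lEV true nothing nothing nothing) (render stable i k ac false φ) (hashCell ∷ modelCells U V)
                               (sweepLeft-∷ (lEV true nothing nothing nothing) hashCell (modelCells U V) (sweepLeft-modelCells _ (skip-evaluation nothing nothing nothing) U V pU pV) refl) p , e

    round-evaluation-first : round EV (tape stable 0 k ac U V) ≡ inj₂ (phaseAfter 0 k , tape updated 0 k ac U V)
    round-evaluation-first with sweepLeft-evaluation 0
    ... | (l' , p , e) = trans (round-turns EV (tape stable 0 k ac U V)
            (sweepRight-++ EV (rKill false k0) (render stable 0 k ac false φ) (hashCell ∷ modelCells U V) (KillSweep.kill-stable 0 k ac kill-atomCells φ false)
               (sweepRight-∷ EV (rKill false k0) hashCell (modelCells U V) refl (sweepRight-kill-done k0 (modelCells U V)))) refl p)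
           (cong (λ z → inj₂ (z , tape updated 0 k ac U V)) e)

    round-evaluation : ∀ i → round EV (tape updated i k ac U V) ≡ inj₂ (phaseAfter (suc i) k , tape updated (suc i) k ac U V)
    round-evaluation i with sweepLeft-evaluation (suc i)
    ... | (l' , p , e) = trans (round-turns EV (tape updated i k ac U V)
            (sweepRight-++ EV (rKill false k0) (render updated i k ac false φ) (hashCell ∷ modelCells U V) (KillSweep.kill-updated i k ac kill-atomCells φ)
               (sweepRight-∷ EV (rKill false k0) hashCell (modelCells U V) refl (sweepRight-kill-done k0 (modelCells U V)))) refl p)
           (cong (λ z → inj₂ (z , tape updated (suc i) k ac U V)) e)

    rounds-evaluation : ∀ d i → suc (suc (d + i)) ≡ h →
      rounds (suc d) EV (tape updated i k ac U V) ≡ inj₂ (CP nothing (evalAt φ k) , tape updated (suc (d + i)) k ac U V)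
    rounds-evaluation zero i eq = trans (rounds-step 0 EV (tape updated i k ac U V) (round-evaluation i))
      (cong (λ z → inj₂ (z , tape updated (suc i) k ac U V)) (phaseAfter-reached (suc i) (trans (cong (λ m → leB m (suc (suc i))) (sym eq)) (leB-refl (suc (suc i))))))
    rounds-evaluation (suc d) i eq = trans (rounds-step (suc d) EV (tape updated i k ac U V) (round-evaluation i))
      (trans (cong (λ z → rounds (suc d) z (tape updated (suc i) k ac U V))
                (phaseAfter-unreached (suc i) (trans (cong (λ m → leB m (suc (suc i))) (sym eq)) (leB-suc+ d i))))
      (trans (rounds-evaluation d (suc i) (trans (cong (λ m → suc (suc m)) (NP.+-suc d i)) eq))
             (cong (λ m → inj₂ (CP nothing (evalAt φ k) , tape updated (suc m) k ac U V)) (NP.+-suc d i))))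

    evaluate : Σ ℕ λ n → (n ≤ suc h) × (rounds n EV (tape stable 0 k ac U V) ≡ inj₂ (CP nothing (evalAt φ k) , tape updated (h ∸ 1) k ac U V))
    evaluate = by-height h refl
      where
      single-round : leB h 1 ≡ true → 0 ≡ h ∸ 1 →
        Σ ℕ λ n → (n ≤ suc h) × (rounds n EV (tape stable 0 k ac U V) ≡ inj₂ (CP nothing (evalAt φ k) , tape updated (h ∸ 1) k ac U V))
      single-round reached h∸1≡0 = 1 , s≤s z≤n ,
        trans (rounds-step 0 EV (tape stable 0 k ac U V) round-evaluation-first)
              (cong₂ (λ z m → inj₂ (z , tape updated m k ac U V)) (phaseAfter-reached 0 reached) h∸1≡0)
      by-height : ∀ m → h ≡ m →
        Σ ℕ λ n → (n ≤ suc h) × (rounds n EV (tape stable 0 k ac U V) ≡ inj₂ (CP nothing (evalAt φ k) , tape updated (h ∸ 1) k ac U V))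
      by-height zero h≡ = single-round (cong (λ m → leB m 1) h≡) (cong (_∸ 1) (sym h≡))
      by-height (suc zero) h≡ = single-round (cong (λ m → leB m 1) h≡) (cong (_∸ 1) (sym h≡))
      by-height (suc (suc d)) h≡ = suc (suc d) , subst (λ m → suc (suc d) ≤ suc m) (sym h≡) (NP.n≤1+n _) ,
        trans (rounds-step (suc d) EV (tape stable 0 k ac U V) round-evaluation-first)
        (trans (cong (λ z → rounds (suc d) z (tape updated 0 k ac U V)) (phaseAfter-unreached 0 (cong (λ m → leB m 1) h≡)))
        (trans (rounds-evaluation d 0 (trans (cong (λ m → suc (suc m)) (NP.+-identityʳ d)) (sym h≡)))
               (cong (λ m → inj₂ (CP nothing (evalAt φ k) , tape updated m k ac U V))
                  (trans (cong suc (NP.+-identityʳ d)) (cong (_∸ 1) (sym h≡))))))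

  mutual
    render-cong : ∀ ph i k ac ac' → (∀ a → ac a ≡ ac' a) → ∀ pe χ → render ph i k ac pe χ ≡ render ph i k ac' pe χ
    render-cong ph i k ac ac' e pe χ = cong (cell (headSym χ) freshMarks (nodeOf ph i k χ pe) ∷_) (renderArgs-cong ph i k ac ac' e (belowValue i χ pe) χ)

    renderArgs-cong : ∀ ph i k ac ac' → (∀ a → ac a ≡ ac' a) → ∀ pe χ → renderArgs ph i k ac pe χ ≡ renderArgs ph i k ac' pe χ
    renderArgs-cong ph i k ac ac' e pe (atom a) = e a
    renderArgs-cong ph i k ac ac' e pe (¬' ψ) = render-cong ph i k ac ac' e pe ψ
    renderArgs-cong ph i k ac ac' e pe (φ₁ ∧' ψ) = cong₂ _++_ (render-cong ph i k ac ac' e pe φ₁) (render-cong ph i k ac ac' e pe ψ)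
    renderArgs-cong ph i k ac ac' e pe (□ ψ) = render-cong ph i k ac ac' e pe ψ

  fetch-atomCells : ∀ k w r f a → sweepRight (CP nothing r) (rFetch false f) (atomCells k w a) ≡ (rFetch false f , atomCells k w a)
  fetch-atomCells k w r f a = fetch-codeCells (fromℕ a) w _ _ r f

  round-fetch : ∀ i' k w U s V r → round (CP nothing r) (tape updated i' k (atomCells k w) U (s ∷ V)) ≡ inj₂ (CP (just s) r , tape updated i' k (atomCells k w) (U ∷ʳ s) V)
  round-fetch i' k w U s V r =
    round-turns (CP nothing r) (tape updated i' k (atomCells k w) U (s ∷ V))
      (sweepRight-++ (CP nothing r) (rFetch false nothing) (render updated i' k (atomCells k w) false φ) (hashCell ∷ modelCells U (s ∷ V))
        (FetchSweep.fetch-render r nothing updated i' k (atomCells k w) (fetch-atomCells k w r nothing) φ false)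
        (sweepRight-∷ (CP nothing r) (rFetch false nothing) hashCell (modelCells U (s ∷ V)) refl (FetchModel.fetch-some (CP nothing r) (λ f x → refl) U s V)))
      refl (sweepLeft-lId (CP (just s) r) _)

  round-fetch-halts : ∀ i' k w U r → round (CP nothing r) (tape updated i' k (atomCells k w) U []) ≡ inj₁ r
  round-fetch-halts i' k w U r =
    round-halts (CP nothing r) (tape updated i' k (atomCells k w) U [])
      (sweepRight-++ (CP nothing r) (rFetch false nothing) (render updated i' k (atomCells k w) false φ) (hashCell ∷ modelCells U [])
        (FetchSweep.fetch-render r nothing updated i' k (atomCells k w) (fetch-atomCells k w r nothing) φ false)
        (sweepRight-∷ (CP nothing r) (rFetch false nothing) hashCell (modelCells U []) refl (FetchModel.fetch-none (CP nothing r) (λ f x → refl) U)))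
      refl

  fetch-digit : ∀ s → Digit s → ∀ r f x → stepR (CP (just s) r) (rFetch true f) x ≡ fetchStep true f x
  fetch-digit .d1 digit1 r f x = refl
  fetch-digit .d2 digit2 r f x = refl

  end-digit : ∀ s → Digit s → ∀ r s' → afterRight (CP (just s) r) (rFetch true (just s')) ≡ inj₂ (lId (CP (just s') r))
  end-digit .d1 digit1 r s' = refl
  end-digit .d2 digit2 r s' = refl

  round-compare : ∀ i' k w s s' U V r → Digit s →
    round (CP (just s) r) (tape updated i' k (atomCells k w) U (s' ∷ V)) ≡ inj₂ (CP (just s') r , tape updated i' k (atomCells k (w ∷ʳ s)) (U ∷ʳ s') V)
  round-compare i' k w s s' U V r ds with CompareSweep.compare-render s r updated i' k (atomCells k w) (atomCells k (w ∷ʳ s)) _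
                                       (λ a → compare-codeCells s ds r (fromℕ a) w (elemᵇ a (take k M))) φ false idle
  ... | (a' , p) =
    round-turns (CP (just s) r) (tape updated i' k (atomCells k w) U (s' ∷ V))
      (sweepRight-++ (CP (just s) r) (rCmp idle) (render updated i' k (atomCells k w) false φ) (hashCell ∷ modelCells U (s' ∷ V)) p
        (sweepRight-∷ (CP (just s) r) (rCmp a') hashCell (modelCells U (s' ∷ V)) refl (FetchModel.fetch-some (CP (just s) r) (fetch-digit s ds r) U s' V)))
      (end-digit s ds r s') (sweepLeft-lId (CP (just s') r) _)

  seenCells : ℕ → List Sym → ℕ → List Cell
  seenCells k w a = codeCells (digits a) [] true (elemᵇ a (take k M) ∨ startsWith (encAtom a) (w ∷ʳ E))

  seenCells-next : ∀ k w m → w ∷ʳ E ≡ encAtom m → take (suc k) M ≡ take k M ++ m ∷ [] →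
    ∀ a → seenCells k w a ≡ atomCells (suc k) [] a
  seenCells-next k w m w≡ take≡ a = cong (codeCells (digits a) [] true) (begin
    elemᵇ a (take k M) ∨ startsWith (encAtom a) (w ∷ʳ E)   ≡⟨ cong (λ z → elemᵇ a (take k M) ∨ startsWith (encAtom a) z) w≡ ⟩
    elemᵇ a (take k M) ∨ startsWith (encAtom a) (encAtom m) ≡⟨ cong (elemᵇ a (take k M) ∨_) (startsWith-encAtom a m) ⟩
    elemᵇ a (take k M) ∨ isYes (a ≟ m)                      ≡⟨ elemᵇ-∷ʳ a (take k M) m ⟨
    elemᵇ a (take k M ∷ʳ m)                                 ≡⟨ cong (elemᵇ a) take≡ ⟨
    elemᵇ a (take (suc k) M)                                ∎)
    where open ≡-Reasoning

  round-compare-last : ∀ i' k w U V r m → leB h (suc i') ≡ true → w ∷ʳ E ≡ encAtom m → take (suc k) M ≡ take k M ++ m ∷ [] → All ≢# U → All ≢# V →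
    round (CP (just E) r) (tape updated i' k (atomCells k w) U V) ≡ inj₂ (EV , tape stable 0 (suc k) (atomCells (suc k) []) U V)
  round-compare-last i' k w U V r m e w≡ take≡ pU pV
    with CompareSweep.compare-render E r updated i' k (atomCells k w) (seenCells k w) _ (λ a → compare-codeCells-last r (fromℕ a) w _ (elemᵇ a (take k M)) refl) φ false idle
  ... | (a' , p) =
    round-turns (CP (just E) r) (tape updated i' k (atomCells k w) U V)
      (sweepRight-++ (CP (just E) r) (rCmp idle) (render updated i' k (atomCells k w) false φ) (hashCell ∷ modelCells U V) p
        (sweepRight-∷ (CP (just E) r) (rCmp a') hashCell (modelCells U V) refl (sweepRight-fetch-done r nothing (modelCells U V))))
      refl
      (sweepLeft-++ (lInit true false) (render updated i' k (seenCells k w) false φ) (hashCell ∷ modelCells U V)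
        (sweepLeft-∷ (lInit true false) hashCell (modelCells U V) (sweepLeft-modelCells (lInit true false) (skip-reinit false) U V pU pV) refl)
        (trans (cong (sweepLeft (lInit false false)) (render-cong updated i' k (seenCells k w) (atomCells (suc k) []) (seenCells-next k w m w≡ take≡) false φ))
               (proj₂ (ReinitSweep.reinit-render i' k (atomCells (suc k) []) reinit-atomCells φ false e false))))
    where
    reinit-atomCells : ∀ a sn0 → sweepLeft (lInit false sn0) (atomCells (suc k) [] a) ≡ (lInit false (elemᵇ a (take (suc k) M)) , atomCells (suc k) [] a)
    reinit-atomCells a sn0 = reinit-codeCells (fromℕ a) [] _ (elemᵇ a (take (suc k) M)) sn0

  rounds-compare : ∀ i' k r m P Rm → leB h (suc i') ≡ true → take (suc k) M ≡ take k M ++ m ∷ [] → All ≢# P → All ≢# Rm →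
    ∀ u w s → encAtom m ≡ w ++ s ∷ u →
    rounds (suc (length u)) (CP (just s) r) (tape updated i' k (atomCells k w) (P ++ (w ++ s ∷ [])) (u ++ Rm))
      ≡ inj₂ (EV , tape stable 0 (suc k) (atomCells (suc k) []) (P ++ encAtom m) Rm)
  rounds-compare i' k r m P Rm e eT pP pR u w s eq with splitCode m w s u eq
  ... | atEnd refl refl ew =
    trans (rounds-step 0 (CP (just E) r) (tape updated i' k (atomCells k w) (P ++ (w ++ E ∷ [])) Rm)
             (round-compare-last i' k w (P ++ (w ++ E ∷ [])) Rm r m e (sym eq) eT
                (AllP.++⁺ pP (subst (All ≢#) eq (encAtom-≢# m))) pR))
          (cong (λ z → inj₂ (EV , tape stable 0 (suc k) (atomCells (suc k) []) (P ++ z) Rm)) (sym eq))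
  ... | atDigit ds (s' , u' , refl) =
    trans (rounds-step (suc (length u')) (CP (just s) r) (tape updated i' k (atomCells k w) (P ++ (w ++ s ∷ [])) (s' ∷ u' ++ Rm))
             (round-compare i' k w s s' (P ++ (w ++ s ∷ [])) (u' ++ Rm) r ds))
    (trans (cong (λ z → rounds (suc (length u')) (CP (just s') r) (tape updated i' k (atomCells k (w ∷ʳ s)) z (u' ++ Rm)))
                 (LP.++-assoc P (w ++ s ∷ []) (s' ∷ [])))
           (rounds-compare i' k r m P Rm e eT pP pR u' (w ∷ʳ s) s' (trans eq (sym (LP.++-assoc w (s ∷ []) (s' ∷ u'))))))

  tapeAt : ℕ → List Cell
  tapeAt k = tape stable 0 k (atomCells k []) (encModel (take k M)) (encModel (drop k M))

  rounds-prefix : ∀ k m rest → drop k M ≡ m ∷ rest →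
    Σ ℕ λ n → (n ≤ suc h + 1 + length (encAtom m)) × (rounds n EV (tapeAt k) ≡ inj₂ (EV , tapeAt (suc k)))
  rounds-prefix k m rest drop≡ with encAtom-∷ m | take-drop-suc k M m rest drop≡
  ... | (s , u , code≡) | (take≡ , drop≡′) = n₁ + suc (suc (length u)) , bound , reaches
    where
    read = encModel (take k M)
    unread = encModel rest
    ev = Evaluation.evaluate k [] read (encModel (drop k M)) (encModel-≢# (take k M)) (encModel-≢# (drop k M))
    n₁ = proj₁ ev
    r = evalAt φ k
    bound : n₁ + suc (suc (length u)) ≤ suc h + 1 + length (encAtom m)
    bound = begin
      n₁ + suc (suc (length u))       ≤⟨ NP.+-monoˡ-≤ (suc (suc (length u))) (proj₁ (proj₂ ev)) ⟩
      suc h + (1 + suc (length u))    ≡⟨ NP.+-assoc (suc h) 1 (suc (length u)) ⟨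
      suc h + 1 + length (s ∷ u)      ≡⟨ cong (λ c → suc h + 1 + length c) code≡ ⟨
      suc h + 1 + length (encAtom m)  ∎
      where open NP.≤-Reasoning
    reaches : rounds (n₁ + suc (suc (length u))) EV (tapeAt k) ≡ inj₂ (EV , tapeAt (suc k))
    reaches = begin
      rounds (n₁ + suc (suc (length u))) EV (tapeAt k)
        ≡⟨ rounds-+ n₁ _ EV (tapeAt k) (proj₂ (proj₂ ev)) ⟩
      rounds (suc (suc (length u))) (CP nothing r) (tape updated (h ∸ 1) k (atomCells k []) read (encModel (drop k M)))
        ≡⟨ cong (λ V → rounds (suc (suc (length u))) (CP nothing r) (tape updated (h ∸ 1) k (atomCells k []) read V))
                (trans (cong encModel drop≡) (cong (_++ unread) code≡)) ⟩
      rounds (suc (suc (length u))) (CP nothing r) (tape updated (h ∸ 1) k (atomCells k []) read (s ∷ u ++ unread))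
        ≡⟨ rounds-step _ _ _ (round-fetch (h ∸ 1) k [] read s (u ++ unread) r) ⟩
      rounds (suc (length u)) (CP (just s) r) (tape updated (h ∸ 1) k (atomCells k []) (read ∷ʳ s) (u ++ unread))
        ≡⟨ rounds-compare (h ∸ 1) k r m read unread (leB-pred h) take≡ (encModel-≢# (take k M)) (encModel-≢# rest) u [] s code≡ ⟩
      inj₂ (EV , tape stable 0 (suc k) (atomCells (suc k) []) (read ++ encAtom m) unread)
        ≡⟨ cong₂ (λ U V → inj₂ (EV , tape stable 0 (suc k) (atomCells (suc k) []) U V)) read≡ (cong encModel (sym drop≡′)) ⟩
      inj₂ (EV , tapeAt (suc k)) ∎
      where
      open ≡-Reasoning
      read≡ : read ++ encAtom m ≡ encModel (take (suc k) M)
      read≡ = trans (cong (read ++_) (sym (LP.++-identityʳ (encAtom m))))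
                    (trans (sym (encModel-++ (take k M) (m ∷ []))) (cong encModel (sym take≡)))

  rounds-final : ∀ k → drop k M ≡ [] → Σ ℕ λ n → (n ≤ suc h + 1) × (rounds n EV (tapeAt k) ≡ inj₁ (evalAt φ k))
  rounds-final k eD = proj₁ ev + 1 , NP.+-monoˡ-≤ 1 (proj₁ (proj₂ ev)) ,
    trans (rounds-+ (proj₁ ev) 1 EV (tapeAt k) (proj₂ (proj₂ ev)))
    (trans (cong (λ z → rounds 1 (CP nothing (evalAt φ k)) (tape updated (h ∸ 1) k (atomCells k []) (encModel (take k M)) z)) (cong encModel eD))
      (rounds-halt 0 (CP nothing (evalAt φ k)) (tape updated (h ∸ 1) k (atomCells k []) (encModel (take k M)) []) (round-fetch-halts (h ∸ 1) k [] (encModel (take k M)) (evalAt φ k))))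
    where
    ev = Evaluation.evaluate k [] (encModel (take k M)) (encModel (drop k M)) (encModel-≢# (take k M)) (encModel-≢# (drop k M))

  rounds-all : ∀ d k → length (drop k M) ≡ d → Σ ℕ λ n → (n ≤ suc d * (suc h + 1) + length (encModel (drop k M))) ×
             Σ Bool λ b → (rounds n EV (tapeAt k) ≡ inj₁ b) × Decides b (M ⊨ φ)
  rounds-all zero k length≡ with rounds-final k (length≡0 (drop k M) length≡)
  ... | (n , n≤ , halts) =
    n , NP.≤-trans n≤ (NP.≤-trans (NP.≤-reflexive (sym (NP.+-identityʳ (suc h + 1)))) (NP.m≤m+n _ _)) ,
    evalAt φ k , halts ,
    subst (λ M′ → Decides (evalAt φ k) (M′ ⊨ φ)) (take-drop-nil k M (length≡0 (drop k M) length≡)) (evalAt-correct φ k)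
  rounds-all (suc d) k length≡ with length≡suc (drop k M) d length≡
  ... | (m , rest , drop≡ , length-rest) with take-drop-suc k M m rest drop≡
  ... | (_ , drop≡′) with rounds-prefix k m rest drop≡ | rounds-all d (suc k) (trans (cong length drop≡′) length-rest)
  ... | (n₁ , n₁≤ , reaches) | (n₂ , n₂≤ , b , halts , decides) =
    n₁ + n₂ , bound , b , trans (rounds-+ n₁ n₂ EV (tapeAt k) reaches) halts , decides
    where
    H = suc h + 1
    bound : n₁ + n₂ ≤ suc (suc d) * H + length (encModel (drop k M))
    bound = begin
      n₁ + n₂
        ≤⟨ NP.+-mono-≤ n₁≤ (subst (λ xs → n₂ ≤ suc d * H + length (encModel xs)) drop≡′ n₂≤) ⟩
      (H + length (encAtom m)) + (suc d * H + length (encModel rest))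
        ≡⟨ +-interchange H (length (encAtom m)) (suc d * H) (length (encModel rest)) ⟩
      (H + suc d * H) + (length (encAtom m) + length (encModel rest))
        ≡⟨ cong (H + suc d * H +_) (LP.length-++ (encAtom m)) ⟨
      (H + suc d * H) + length (encModel (m ∷ rest))
        ≡⟨ cong (λ xs → H + suc d * H + length (encModel xs)) drop≡ ⟨
      suc (suc d) * H + length (encModel (drop k M)) ∎
      where open NP.≤-Reasoning

  initial-atomCells : ∀ a → map initialCell (encAtom a) ≡ atomCells 0 [] a
  initial-atomCells a = trans (LP.map-++ initialCell (encBin (fromℕ a)) (E ∷ []))
    (cong₂ _++_ (initial-digits (fromℕ a)) (cong (λ z → cell E (marks z true false) (node true dead) ∷ []) (sym (overrun-[] (encBin (fromℕ a))))))

  initial-render : ∀ χ → map initialCell (encFml χ) ≡ render stable 0 0 (atomCells 0 []) false χ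
  initial-render (atom a) = cong (cell A freshMarks (node true (val false)) ∷_) (initial-atomCells a)
  initial-render (¬' ψ) = cong (cell N freshMarks (node true op) ∷_) (initial-render ψ)
  initial-render (□ ψ) = cong (cell B freshMarks (node true op) ∷_) (initial-render ψ)
  initial-render (φ₁ ∧' ψ) = cong (cell K freshMarks (node true op) ∷_) (trans (LP.map-++ initialCell (encFml φ₁) (encFml ψ)) (cong₂ _++_ (initial-render φ₁) (initial-render ψ)))

  initial-tape : map initialCell (input φ M) ≡ tapeAt 0
  initial-tape = trans (LP.map-++ initialCell (encFml φ) (# ∷ encModel M)) (cong₂ _++_ (initial-render φ) (cong (hashCell ∷_) (initial-modelCells M)))

  input-nonempty : Σ Sym λ s0 → Σ (List Sym) λ ss → input φ M ≡ s0 ∷ ss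
  input-nonempty with encFml φ
  ... | [] = # , encModel M , refl
  ... | x ∷ xs = x , xs ++ # ∷ encModel M , refl

  length-input : length (input φ M) ≡ length (encFml φ) + suc (length (encModel M))
  length-input = LP.length-++ (encFml φ)

  encModel≤input : length (encModel M) ≤ length (input φ M)
  encModel≤input = NP.≤-trans (NP.n≤1+n _) (NP.≤-trans (NP.m≤n+m _ (length (encFml φ))) (NP.≤-reflexive (sym length-input)))

  encFml≤input : length (encFml φ) ≤ length (input φ M)
  encFml≤input = NP.≤-trans (NP.m≤m+n _ _) (NP.≤-reflexive (sym length-input))

  rounds-bound : let n = suc (length (input φ M)) in
    suc (length M) * (suc h + 1) + length (encModel M) ≤ n * n + n * n
  rounds-bound = NP.+-mono-≤ (NP.*-mono-≤ prefixes≤ rounds≤) (NP.≤-trans (NP.m≤n⇒m≤1+n encModel≤input) (NP.m≤m*n _ _))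
    where
    prefixes≤ : suc (length M) ≤ suc (length (input φ M))
    prefixes≤ = s≤s (NP.≤-trans (length≤encModel M) encModel≤input)
    rounds≤ : suc h + 1 ≤ suc (length (input φ M))
    rounds≤ = subst (_≤ suc (length (input φ M))) (NP.+-comm 1 (suc h)) (s≤s (NP.≤-trans (height<length φ) encFml≤input))

  decide : Σ ℕ λ t → Σ Bool λ b →
    (t ≤ 4 * (suc (length (input φ M)) ^ 3)) × HaltsWithin evaluator (input φ M) t b × Decides b (M ⊨ φ)
  decide with input-nonempty | rounds-all (length M) 0 refl
  ... | (s , ss , input≡) | (n , n≤ , b , halts , decides) =
    n * roundTime (length ss) , b ,
    cube-bound {a = suc (length (input φ M))} (NP.≤-trans n≤ rounds-bound) (roundTime≤ (cong length input≡)) ,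
    subst (λ w → HaltsWithin evaluator w (n * roundTime (length ss)) b) (sym input≡) (run-evaluator s ss n b initial-halts) ,
    decides
    where
    initial-halts : rounds n EV (map initialCell (s ∷ ss)) ≡ inj₁ b
    initial-halts = subst (λ w → rounds n EV (map initialCell w) ≡ inj₁ b) input≡ (trans (cong (rounds n EV) initial-tape) halts)

lemma1 : Σ TM λ T → Σ ℕ λ c → Σ ℕ λ d →
    (φ : Fml) (M : Model) → Unique M →
    Σ ℕ λ t → Σ Bool λ b →
    (t ≤ c * (suc (length (input φ M)) ^ d))
    × HaltsWithin T (input φ M) t b
    × (b ≡ true → M ⊨ φ)
    × (b ≡ false → ¬ (M ⊨ φ))
lemma1 = evaluator , 4 , 3 , λ φ M _ → Correctness.decide φ M
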